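{- Consider the algorithm TRIÈST-IMPR with integer parameter $M\ge6$ run on an insertion-only edge stream (described in the context), and let $\tau^{(t)}$ be the value of its counter $\tau$ at the end of time step $t$. Then $\tau^{(t)}=|\Delta^{(t)}|$ if $t\le M$, and $\mathbb{E}\left[\tau^{(t)}\right]=|\Delta^{(t)}|$ if $t>M$.
   Context: Insertion-only edge stream: a sequence $e_1,e_2,\dots$ of distinct undirected edges in arbitrary order fixed independently of the algorithm's random bits; $G^{(t)}$ is the graph of the first $t$ edges. A triangle is a set of three edges $\{(u,v),(v,w),(w,u)\}$ with $u,v,w$ distinct; $\Delta^{(t)}$ is the set of triangles of $G^{(t)}$. TRIÈST-IMPR keeps an edge sample $\mathcal{S}$ (initially empty) and a counter $\tau$ (initially $0$). At time $t$, when $e_t=(u,v)$ arrives, it first computes, with $\mathcal{S}$ as at the end of time $t-1$, the set $\mathcal{N}^{\mathcal{S}}_{u,v}$ of vertices adjacent to both $u$ and $v$ in the graph with edge set $\mathcal{S}$, and increases $\tau$ by $\eta^{(t)}|\mathcal{N}^{\mathcal{S}}_{u,v}|$, where $\eta^{(t)}=\max\{1,(t-1)(t-2)/(M(M-1))\}$. Then it updates $\mathcal{S}$ by reservoir sampling: if $t\le M$, $e_t$ is inserted in $\mathcal{S}$; if $t>M$, with probability $M/t$ (independent randomness) an edge chosen uniformly at random from $\mathcal{S}$ is removed and $e_t$ is inserted, otherwise $\mathcal{S}$ is unchanged. The counter is never decreased. The estimate at time $t$ is $\tau^{(t)}$. -}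

module Defs where

open import Data.Nat as ℕ using (ℕ; zero; suc; _≤?_; _<?_; _<_; _≤_; _∸_)
import Data.Nat.Properties as ℕP
open import Data.Integer using (+_)
open import Data.Rational as ℚ using (ℚ; 0ℚ; 1ℚ; _/_)
open import Data.Product using (_×_; _,_; proj₁; proj₂; Σ)
open import Data.Sum using (_⊎_)
open import Data.Fin using (Fin)
open import Data.List using (List; []; _∷_; _++_; [_]; length; map; concatMap; filter; deduplicate; removeAt; allFin; foldr; take)
open import Data.List.Relation.Unary.All using (All)
open import Data.List.Relation.Unary.Any using (Any; any?)
open import Data.List.Relation.Unary.AllPairs using (AllPairs)
open import Relation.Binary.PropositionalEquality using (_≡_; _≢_)
open import Relation.Nullary using (Dec; yes; no; ¬_)
open import Relation.Nullary.Decidable using (_×-dec_; _⊎-dec_)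

-- Graphs given by edge streams.  Vertices are natural numbers; an edge
-- is stored as an ordered pair, but read as an undirected edge.

Edge : Set
Edge = ℕ × ℕ

_≈ₑ_ : Edge → Edge → Set
(a , b) ≈ₑ (c , d) = (a ≡ c × b ≡ d) ⊎ (a ≡ d × b ≡ c)

_≈ₑ?_ : (e f : Edge) → Dec (e ≈ₑ f)
(a , b) ≈ₑ? (c , d) = ((a ℕ.≟ c) ×-dec (b ℕ.≟ d)) ⊎-dec ((a ℕ.≟ d) ×-dec (b ℕ.≟ c))

ValidStream : List Edge → Set
ValidStream σ = All (λ e → proj₁ e ≢ proj₂ e) σ × AllPairs (λ e f → ¬ (e ≈ₑ f)) σ

Adj : List Edge → ℕ → ℕ → Set
Adj E x y = Any (λ e → e ≈ₑ (x , y)) E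

Adj? : (E : List Edge) (x y : ℕ) → Dec (Adj E x y)
Adj? E x y = any? (λ e → e ≈ₑ? (x , y)) E

-- Triangles of the graph with edge set E.
-- A triangle {(u,v),(v,w),(w,u)} (u,v,w distinct) is determined by its
-- vertex set {u,v,w}; we count it once via its increasing listing u<v<w.

endpoints : List Edge → List ℕ
endpoints E = deduplicate ℕ._≟_ (concatMap (λ e → proj₁ e ∷ proj₂ e ∷ []) E)

IsTriangle : List Edge → ℕ × ℕ × ℕ → Set
IsTriangle E (u , v , w) = (u < v × v < w) × (Adj E u v × Adj E v w × Adj E w u)

IsTriangle? : (E : List Edge) (t : ℕ × ℕ × ℕ) → Dec (IsTriangle E t)
IsTriangle? E (u , v , w) =
  ((u <? v) ×-dec (v <? w)) ×-dec (Adj? E u v ×-dec (Adj? E v w ×-dec Adj? E w u))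

triples : List ℕ → List (ℕ × ℕ × ℕ)
triples V = concatMap (λ u → concatMap (λ v → map (λ w → (u , v , w)) V) V) V

numTriangles : List Edge → ℕ
numTriangles E = length (filter (IsTriangle? E) (triples (endpoints E)))

Dist : Set → Set
Dist A = List (ℚ × A)

return : ∀ {A : Set} → A → Dist A
return x = (1ℚ , x) ∷ []

_>>=_ : ∀ {A B : Set} → Dist A → (A → Dist B) → Dist B
d >>= f = concatMap (λ px → map (λ qy → (proj₁ px ℚ.* proj₁ qy , proj₂ qy)) (f (proj₂ px))) d

𝔼 : ∀ {A : Set} → Dist A → (A → ℚ) → ℚ
𝔼 d f = foldr (λ px acc → proj₁ px ℚ.* f (proj₂ px) ℚ.+ acc) 0ℚ d

-- n / d as a rational (d = 0 never used below with meaningful value)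
frac : ℕ → ℕ → ℚ
frac n zero    = 0ℚ
frac n (suc d) = (+ n) / suc d

fromℕ : ℕ → ℚ
fromℕ n = frac n 1

State : Set
State = List Edge × ℚ

sample : State → List Edge
sample = proj₁

counter : State → ℚ
counter = proj₂

-- vertices adjacent to u in S (possibly with repetitions)
nbrs : List Edge → ℕ → List ℕ
nbrs S u = concatMap (λ e → f e) S
  where
  f : Edge → List ℕ
  f (a , b) with a ℕ.≟ u | b ℕ.≟ u
  ... | yes _ | _     = b ∷ []
  ... | no _  | yes _ = a ∷ []
  ... | no _  | no _  = []

commonNbrs : List Edge → ℕ → ℕ → List ℕ
commonNbrs S u v = deduplicate ℕ._≟_ (filter (Adj? S v) (nbrs S u))

η : ℕ → ℕ → ℚ
η M t = 1ℚ ℚ.⊔ frac ((t ∸ 1) ℕ.* (t ∸ 2)) (M ℕ.* (M ∸ 1))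

step : (M t : ℕ) → Edge → State → Dist State
step M t (u , v) (S , τ) with t ≤? M
... | yes _ = return (S ++ [ (u , v) ] , τ')
  where τ' = τ ℚ.+ η M t ℚ.* fromℕ (length (commonNbrs S u v))
... | no _ =
      map (λ i → (frac M t ℚ.* frac 1 (length S) , (removeAt S i ++ [ (u , v) ] , τ')))
          (allFin (length S))
      ++ ((1ℚ ℚ.- frac M t , (S , τ')) ∷ [])
  where τ' = τ ℚ.+ η M t ℚ.* fromℕ (length (commonNbrs S u v))

-- process the remaining stream, the next arriving edge having time suc t
runFrom : (M t : ℕ) → Dist State → List Edge → Dist State
runFrom M t d []       = d
runFrom M t d (e ∷ es) = runFrom M (suc t) (d >>= step M (suc t) e) es

triestImpr : (M : ℕ) → List Edge → Dist State
triestImpr M σ = runFrom M 0 (return ([] , 0ℚ)) σ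

-- While t ≤ M nothing is evicted and η = 1, so τ grows at each arrival (u , v) by |N_{u,v}|, which is exactly
-- the number of triangles closed by (u , v). Beyond M the sample is a uniform M-subset of the stream; by induction
-- along the stream each edge lies in it with probability M / t and each pair of distinct edges with probability
-- M (M - 1) / (t (t - 1)), since an arrival keeps an old edge with probability 1 - 1 / t, an old pair with
-- probability 1 - 2 / t, and puts the new edge in with probability M / t. A triangle closed at time t is a wedge
-- u – w – v of G^(t-1) and is counted iff both its edges are sampled, which happens with probability
-- M (M - 1) / ((t - 1) (t - 2)) = 1 / η^(t); so each arrival raises E[τ] by the number of new triangles.

module Submission where

open import Defs
open import Data.Nat using (ℕ; _≤_)
open import Data.List using (List; length)
open import Data.List.Membership.Propositional using (_∈_)
open import Data.Product using (_×_; _,_)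
open import Data.Rational using (ℚ; 0ℚ)
open import Relation.Binary.PropositionalEquality using (_≡_)

open import Data.Product using (proj₁; proj₂; ∃-syntax)
open import Data.Product.Properties using (≡-dec)
import Data.Nat as ℕ
open Data.Nat using (zero; suc; _<_; _∸_; z≤n; s≤s)
import Data.Nat.Properties as ℕP
open import Data.Nat.ListAction using (sum)
open import Data.Nat.Tactic.RingSolver using (solve-∀)
open import Data.Integer as ℤ using (+_)
import Data.Integer.Properties as ℤP
import Data.Rational as ℚ
open Data.Rational using (1ℚ; toℚᵘ)
import Data.Rational.Properties as ℚP
open import Data.Rational.Unnormalised as ℚᵘ using (mkℚᵘ; *≡*)
import Data.Rational.Unnormalised.Properties as ℚᵘP
open import Data.Rational.Solver using (module +-*-Solver)
open +-*-Solver using (solve; _:+_; _:*_; _:-_; _:=_; con)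
open import Data.List using ([]; _∷_; _++_; [_]; map; filter; concatMap; allFin; removeAt; tabulate)
import Data.List.Properties as LP
open import Data.List.Reverse using (Reverse; []; _∶_∶ʳ_; reverseView)
open import Data.List.Membership.Propositional using (_∉_; _─_; find; lose)
import Data.List.Membership.Propositional.Properties as MP
open import Data.List.Relation.Binary.Subset.Propositional using (_⊆_)
open import Data.List.Relation.Unary.Any using (here; there; index)
import Data.List.Relation.Unary.Any.Properties as AnyP
open import Data.List.Relation.Unary.All as All using (All; []; _∷_)
import Data.List.Relation.Unary.All.Properties as AllP
open import Data.List.Relation.Unary.AllPairs using (AllPairs; []; _∷_)
open import Data.List.Relation.Unary.Unique.Propositional using (Unique)
import Data.List.Relation.Unary.Unique.Propositional.Properties as UP
import Data.List.Relation.Unary.Unique.DecPropositional.Properties as UDP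
open import Data.Empty using (⊥-elim)
open import Function using (id; _∘_)
import Data.Sum as Sum
open Sum using (_⊎_; inj₁; inj₂)
open import Relation.Nullary using (Dec; yes; no; ¬_)
open import Relation.Nullary.Decidable using (_×-dec_; ¬?)
open import Relation.Unary using (Decidable)
open import Relation.Binary.Definitions using (DecidableEquality)
open import Relation.Binary.PropositionalEquality
  using (_≢_; refl; sym; trans; cong; cong₂; subst; subst₂; module ≡-Reasoning)

-- Counting in lists

𝟙 : {P : Set} → Dec P → ℕ
𝟙 (yes _) = 1
𝟙 (no _)  = 0

𝟙-true : {P : Set} (P? : Dec P) → P → 𝟙 P? ≡ 1
𝟙-true (yes _) _ = refl
𝟙-true (no ¬p) p = ⊥-elim (¬p p)

𝟙-false : {P : Set} (P? : Dec P) → ¬ P → 𝟙 P? ≡ 0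
𝟙-false (yes p) ¬p = ⊥-elim (¬p p)
𝟙-false (no _)  _  = refl

𝟙-cong : {P Q : Set} (P? : Dec P) (Q? : Dec Q) → (P → Q) → (Q → P) → 𝟙 P? ≡ 𝟙 Q?
𝟙-cong (yes _) (yes _) _ _ = refl
𝟙-cong (yes p) (no ¬q) f _ = ⊥-elim (¬q (f p))
𝟙-cong (no ¬p) (yes q) _ g = ⊥-elim (¬p (g q))
𝟙-cong (no _)  (no _)  _ _ = refl

𝟙-× : {P Q : Set} (P? : Dec P) (Q? : Dec Q) → 𝟙 (P? ×-dec Q?) ≡ 𝟙 P? ℕ.* 𝟙 Q?
𝟙-× (yes _) (yes _) = refl
𝟙-× (yes _) (no _)  = refl
𝟙-× (no _)  (yes _) = refl
𝟙-× (no _)  (no _)  = refl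

module _ {A : Set} where

  sum-map-1≡length : (f : A → ℕ) (xs : List A) → (∀ x → f x ≡ 1) → sum (map f xs) ≡ length xs
  sum-map-1≡length f []       _  = refl
  sum-map-1≡length f (x ∷ xs) f≡1 = cong₂ ℕ._+_ (f≡1 x) (sum-map-1≡length f xs f≡1)

  sum-𝟙≡length-filter : {P : A → Set} (P? : Decidable P) (xs : List A) →
    sum (map (𝟙 ∘ P?) xs) ≡ length (filter P? xs)
  sum-𝟙≡length-filter P? []       = refl
  sum-𝟙≡length-filter P? (x ∷ xs) with P? x
  ... | yes _ = cong suc (sum-𝟙≡length-filter P? xs)
  ... | no _  = sum-𝟙≡length-filter P? xs

  length-filter-partition : {P Q : A → Set} (P? : Decidable P) (Q? : Decidable Q) →
    (∀ {x} → P x → Q x) → (xs : List A) →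
    length (filter Q? xs) ≡ length (filter P? xs) ℕ.+ length (filter (λ x → Q? x ×-dec ¬? (P? x)) xs)
  length-filter-partition P? Q? P⇒Q [] = refl
  length-filter-partition P? Q? P⇒Q (x ∷ xs) with P? x | Q? x
  ... | yes _ | yes _ = cong suc (length-filter-partition P? Q? P⇒Q xs)
  ... | yes p | no ¬q = ⊥-elim (¬q (P⇒Q p))
  ... | no _  | yes _ = trans (cong suc (length-filter-partition P? Q? P⇒Q xs)) (sym (ℕP.+-suc _ _))
  ... | no _  | no _  = length-filter-partition P? Q? P⇒Q xs

  ∈-─ : ∀ {x z} {xs : List A} (x∈xs : x ∈ xs) → z ∈ xs → z ≢ x → z ∈ xs ─ x∈xs
  ∈-─ (here refl) (here refl) z≢x = ⊥-elim (z≢x refl)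
  ∈-─ (here refl) (there z∈xs) _ = z∈xs
  ∈-─ (there _) (here refl) _ = here refl
  ∈-─ (there x∈xs) (there z∈xs) z≢x = there (∈-─ x∈xs z∈xs z≢x)

  length-mono-⊆ : ∀ {xs ys : List A} → Unique xs → xs ⊆ ys → length xs ≤ length ys
  length-mono-⊆ {[]} _ _ = z≤n
  length-mono-⊆ {x ∷ xs} {ys} (x∉xs ∷ !xs) xs⊆ys =
    subst (suc (length xs) ≤_) (sym (LP.length-removeAt′ ys (index x∈ys)))
      (s≤s (length-mono-⊆ !xs λ z∈xs →
        ∈-─ x∈ys (xs⊆ys (there z∈xs)) λ z≡x → All.lookup x∉xs z∈xs (sym z≡x)))
    where x∈ys = xs⊆ys (here refl)

  ⊆⊇⇒length≡ : ∀ {xs ys : List A} → Unique xs → Unique ys → xs ⊆ ys → ys ⊆ xs → length xs ≡ length ys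
  ⊆⊇⇒length≡ !xs !ys xs⊆ys ys⊆xs = ℕP.≤-antisym (length-mono-⊆ !xs xs⊆ys) (length-mono-⊆ !ys ys⊆xs)

  sum-map-∷ : (f g : List A → ℕ) (x : A) (Rs : List (List A)) → (∀ R → f (x ∷ R) ≡ g R) →
    sum (map f (map (x ∷_) Rs)) ≡ sum (map g Rs)
  sum-map-∷ f g x Rs f≡g = cong sum (trans (sym (LP.map-∘ Rs)) (LP.map-cong f≡g Rs))

  removals : List A → List (List A)
  removals []       = []
  removals (x ∷ xs) = xs ∷ map (x ∷_) (removals xs)

  tabulate-removeAt : (xs : List A) → tabulate (removeAt xs) ≡ removals xs
  tabulate-removeAt []       = refl
  tabulate-removeAt (x ∷ xs) =
    cong (xs ∷_) (trans (sym (LP.map-tabulate (removeAt xs) (x ∷_))) (cong (map (x ∷_)) (tabulate-removeAt xs)))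

  map-removeAt-allFin : (xs : List A) → map (removeAt xs) (allFin (length xs)) ≡ removals xs
  map-removeAt-allFin xs = trans (LP.map-tabulate (λ i → i) (removeAt xs)) (tabulate-removeAt xs)

  length-removals : (xs : List A) → length (removals xs) ≡ length xs
  length-removals []       = refl
  length-removals (x ∷ xs) = cong suc (trans (LP.length-map (x ∷_) (removals xs)) (length-removals xs))

  removals-⊆ : (xs : List A) → All (_⊆ xs) (removals xs)
  removals-⊆ []       = []
  removals-⊆ (x ∷ xs) = there ∷ AllP.map⁺ (All.map ∷-mono (removals-⊆ xs))
    where
    ∷-mono : ∀ {R} → R ⊆ xs → x ∷ R ⊆ x ∷ xs
    ∷-mono R⊆xs (here refl) = here refl
    ∷-mono R⊆xs (there z∈R) = there (R⊆xs z∈R)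

  removals-length : (xs : List A) → All (λ R → suc (length R) ≡ length xs) (removals xs)
  removals-length []       = []
  removals-length (x ∷ xs) = refl ∷ AllP.map⁺ (All.map (cong suc) (removals-length xs))

  removals-unique : {xs : List A} → Unique xs → All Unique (removals xs)
  removals-unique {[]}     _ = []
  removals-unique {x ∷ xs} (x∉xs ∷ !xs) =
    !xs ∷ AllP.map⁺ (All.zipWith (λ (!R , R⊆xs) → All.tabulate (All.lookup x∉xs ∘ R⊆xs) ∷ !R)
                                 (removals-unique !xs , removals-⊆ xs))

  length-++-[] : (xs : List A) (y : A) → length (xs ++ [ y ]) ≡ suc (length xs)
  length-++-[] xs y = trans (LP.length-++ xs) (ℕP.+-comm (length xs) 1)

  AllPairs-init : {R : A → A → Set} (xs : List A) {y : A} → AllPairs R (xs ++ [ y ]) → AllPairs R xs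
  AllPairs-init []       _              = []
  AllPairs-init (x ∷ xs) (Rx ∷ Rxs) = AllP.++⁻ˡ xs Rx ∷ AllPairs-init xs Rxs

  AllPairs-last : {R : A → A → Set} (xs : List A) {y : A} → AllPairs R (xs ++ [ y ]) → ∀ {x} → x ∈ xs → R x y
  AllPairs-last (x ∷ xs) (Rx ∷ _)   (here refl) = All.lookup Rx (MP.∈-++⁺ʳ xs (here refl))
  AllPairs-last (x ∷ xs) (_ ∷ Rxs) (there x∈xs) = AllPairs-last xs Rxs x∈xs

module _ {A B : Set} where

  Unique-concatMap⁺ : (g : A → List B) {xs : List A} → Unique xs → (∀ x → Unique (g x)) →
    (∀ {x x′ z} → z ∈ g x → z ∈ g x′ → x ≡ x′) → Unique (concatMap g xs)
  Unique-concatMap⁺ g {[]}     _            _   _        = []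
  Unique-concatMap⁺ g {x ∷ xs} (x∉xs ∷ !xs) !g g-disj = UP.++⁺ (!g x) (Unique-concatMap⁺ g !xs !g g-disj) disjoint
    where
    disjoint : ∀ {z} → ¬ (z ∈ g x × z ∈ concatMap g xs)
    disjoint (z∈gx , z∈gxs) with find (MP.∈-concatMap⁻ g {xs = xs} z∈gxs)
    ... | x′ , x′∈xs , z∈gx′ = All.lookup x∉xs x′∈xs (g-disj z∈gx z∈gx′)

  Unique-map⁺-local : (f : A → B) {xs : List A} → Unique xs →
    (∀ {x y} → x ∈ xs → y ∈ xs → f x ≡ f y → x ≡ y) → Unique (map f xs)
  Unique-map⁺-local f {[]}     _            _     = []
  Unique-map⁺-local f {x ∷ xs} (x∉xs ∷ !xs) f-inj =
    AllP.map⁺ (All.tabulate λ y∈xs fx≡fy → All.lookup x∉xs y∈xs (f-inj (here refl) (there y∈xs) fx≡fy))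
    ∷ Unique-map⁺-local f !xs (λ x∈ y∈ → f-inj (there x∈) (there y∈))

module MembershipCount {A : Set} (_≟_ : DecidableEquality A) where

  open import Data.List.Membership.DecPropositional _≟_ using (_∈?_)
  open ≡-Reasoning

  𝟙∈ : A → List A → ℕ
  𝟙∈ a xs = 𝟙 (a ∈? xs)

  𝟙∈² : A → A → List A → ℕ
  𝟙∈² a b xs = 𝟙∈ a xs ℕ.* 𝟙∈ b xs

  𝟙∈-∈ : ∀ {a xs} → a ∈ xs → 𝟙∈ a xs ≡ 1
  𝟙∈-∈ {a} {xs} = 𝟙-true (a ∈? xs)

  𝟙∈-∉ : ∀ {a xs} → a ∉ xs → 𝟙∈ a xs ≡ 0
  𝟙∈-∉ {a} {xs} = 𝟙-false (a ∈? xs)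

  𝟙∈-head : ∀ a xs → 𝟙∈ a (a ∷ xs) ≡ 1
  𝟙∈-head a xs = 𝟙∈-∈ (here refl)

  𝟙∈-∷-≢ : ∀ {a x} xs → a ≢ x → 𝟙∈ a (x ∷ xs) ≡ 𝟙∈ a xs
  𝟙∈-∷-≢ {a} {x} xs a≢x =
    𝟙-cong (a ∈? (x ∷ xs)) (a ∈? xs) (λ { (here a≡x) → ⊥-elim (a≢x a≡x) ; (there a∈xs) → a∈xs }) there

  𝟙∈-last : ∀ e xs → 𝟙∈ e (xs ++ [ e ]) ≡ 1
  𝟙∈-last e xs = 𝟙∈-∈ (MP.∈-++⁺ʳ xs (here refl))

  𝟙∈-++-≢ : ∀ {a e} xs → a ≢ e → 𝟙∈ a (xs ++ [ e ]) ≡ 𝟙∈ a xs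
  𝟙∈-++-≢ {a} {e} xs a≢e = 𝟙-cong (a ∈? (xs ++ [ e ])) (a ∈? xs)
    (λ a∈ → Sum.[ id , (λ { (here a≡e) → ⊥-elim (a≢e a≡e) }) ] (MP.∈-++⁻ xs a∈)) MP.∈-++⁺ˡ

  𝟙∈²-comm : ∀ a b xs → 𝟙∈² a b xs ≡ 𝟙∈² b a xs
  𝟙∈²-comm a b xs = ℕP.*-comm (𝟙∈ a xs) (𝟙∈ b xs)

  -- A member of a duplicate-free list survives all of its deletions but one, and two distinct members all but
  -- two; the identities are stated additively to avoid truncated subtraction.
  sum-𝟙∈-removals : ∀ a {xs} → Unique xs →
    sum (map (𝟙∈ a) (removals xs)) ℕ.+ 𝟙∈ a xs ≡ 𝟙∈ a xs ℕ.* length xs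
  sum-𝟙∈-removals a {[]}     []           = refl
  sum-𝟙∈-removals a {x ∷ xs} (x∉xs ∷ !xs) = by-cases (a ≟ x)
    where
    n = length xs
    by-cases : Dec (a ≡ x) →
      sum (map (𝟙∈ a) (removals (x ∷ xs))) ℕ.+ 𝟙∈ a (x ∷ xs) ≡ 𝟙∈ a (x ∷ xs) ℕ.* suc n
    by-cases (yes refl) = begin
        𝟙∈ a xs ℕ.+ sum (map (𝟙∈ a) (map (a ∷_) (removals xs))) ℕ.+ 𝟙∈ a (a ∷ xs)
      ≡⟨ cong₂ (λ k s → k ℕ.+ s ℕ.+ 𝟙∈ a (a ∷ xs))
               (𝟙∈-∉ (λ a∈xs → All.lookup x∉xs a∈xs refl))
               (trans (sum-map-∷ (𝟙∈ a) (λ _ → 1) a (removals xs) (𝟙∈-head a))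
                      (trans (sum-map-1≡length _ (removals xs) (λ _ → refl)) (length-removals xs))) ⟩
        n ℕ.+ 𝟙∈ a (a ∷ xs)
      ≡⟨ cong (n ℕ.+_) (𝟙∈-head a xs) ⟩
        n ℕ.+ 1
      ≡⟨ trans (ℕP.+-comm n 1) (sym (ℕP.*-identityˡ (suc n))) ⟩
        1 ℕ.* suc n
      ≡⟨ cong (ℕ._* suc n) (sym (𝟙∈-head a xs)) ⟩
        𝟙∈ a (a ∷ xs) ℕ.* suc n
      ∎
    by-cases (no a≢x) = begin
        k ℕ.+ sum (map (𝟙∈ a) (map (x ∷_) (removals xs))) ℕ.+ 𝟙∈ a (x ∷ xs)
      ≡⟨ cong₂ (λ s k′ → k ℕ.+ s ℕ.+ k′)
               (sum-map-∷ (𝟙∈ a) (𝟙∈ a) x (removals xs) (λ R → 𝟙∈-∷-≢ R a≢x))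
               (𝟙∈-∷-≢ xs a≢x) ⟩
        k ℕ.+ sum (map (𝟙∈ a) (removals xs)) ℕ.+ k
      ≡⟨ ℕP.+-assoc k _ k ⟩
        k ℕ.+ (sum (map (𝟙∈ a) (removals xs)) ℕ.+ k)
      ≡⟨ cong (k ℕ.+_) (sum-𝟙∈-removals a !xs) ⟩
        k ℕ.+ k ℕ.* n
      ≡⟨ sym (ℕP.*-suc k n) ⟩
        k ℕ.* suc n
      ≡⟨ cong (ℕ._* suc n) (sym (𝟙∈-∷-≢ xs a≢x)) ⟩
        𝟙∈ a (x ∷ xs) ℕ.* suc n
      ∎
      where k = 𝟙∈ a xs

  private
    two-more-deletions : ∀ s k n → s ℕ.+ k ≡ k ℕ.* n → s ℕ.+ 2 ℕ.* k ≡ k ℕ.* suc n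
    two-more-deletions s k n s+k≡kn = begin
      s ℕ.+ 2 ℕ.* k  ≡⟨ regroup s k ⟩
      s ℕ.+ k ℕ.+ k  ≡⟨ cong (ℕ._+ k) s+k≡kn ⟩
      k ℕ.* n ℕ.+ k  ≡⟨ ℕP.+-comm (k ℕ.* n) k ⟩
      k ℕ.+ k ℕ.* n  ≡⟨ sym (ℕP.*-suc k n) ⟩
      k ℕ.* suc n    ∎
      where
      regroup : ∀ s k → s ℕ.+ 2 ℕ.* k ≡ s ℕ.+ k ℕ.+ k
      regroup = solve-∀

  sum-𝟙∈²-removals-head : ∀ {a b} xs → b ≢ a → a ∉ xs → Unique xs →
    sum (map (𝟙∈² a b) (removals (a ∷ xs))) ℕ.+ 2 ℕ.* 𝟙∈² a b (a ∷ xs)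
      ≡ 𝟙∈² a b (a ∷ xs) ℕ.* suc (length xs)
  sum-𝟙∈²-removals-head {a} {b} xs b≢a a∉xs !xs = begin
      𝟙∈² a b xs ℕ.+ sum (map (𝟙∈² a b) (map (a ∷_) (removals xs))) ℕ.+ 2 ℕ.* 𝟙∈² a b (a ∷ xs)
    ≡⟨ cong₂ (λ p s → p ℕ.+ s ℕ.+ 2 ℕ.* 𝟙∈² a b (a ∷ xs))
             (cong (ℕ._* 𝟙∈ b xs) (𝟙∈-∉ a∉xs)) (sum-map-∷ (𝟙∈² a b) (𝟙∈ b) a (removals xs) 𝟙∈²-head) ⟩
      sum (map (𝟙∈ b) (removals xs)) ℕ.+ 2 ℕ.* 𝟙∈² a b (a ∷ xs)
    ≡⟨ cong (λ p → sum (map (𝟙∈ b) (removals xs)) ℕ.+ 2 ℕ.* p) (𝟙∈²-head xs) ⟩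
      sum (map (𝟙∈ b) (removals xs)) ℕ.+ 2 ℕ.* 𝟙∈ b xs
    ≡⟨ two-more-deletions _ (𝟙∈ b xs) (length xs) (sum-𝟙∈-removals b !xs) ⟩
      𝟙∈ b xs ℕ.* suc (length xs)
    ≡⟨ cong (ℕ._* suc (length xs)) (sym (𝟙∈²-head xs)) ⟩
      𝟙∈² a b (a ∷ xs) ℕ.* suc (length xs)
    ∎
    where
    𝟙∈²-head : ∀ R → 𝟙∈² a b (a ∷ R) ≡ 𝟙∈ b R
    𝟙∈²-head R = trans (cong₂ ℕ._*_ (𝟙∈-head a R) (𝟙∈-∷-≢ R b≢a)) (ℕP.*-identityˡ _)

  sum-𝟙∈²-removals : ∀ {a b} → a ≢ b → ∀ {xs} → Unique xs →
    sum (map (𝟙∈² a b) (removals xs)) ℕ.+ 2 ℕ.* 𝟙∈² a b xs ≡ 𝟙∈² a b xs ℕ.* length xs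
  sum-𝟙∈²-removals a≢b {[]}     []           = refl
  sum-𝟙∈²-removals {a} {b} a≢b {x ∷ xs} (x∉xs ∷ !xs) = by-cases (a ≟ x) (b ≟ x)
    where
    n = length xs
    x∉xs′ : x ∉ xs
    x∉xs′ x∈xs = All.lookup x∉xs x∈xs refl
    by-cases : Dec (a ≡ x) → Dec (b ≡ x) →
      sum (map (𝟙∈² a b) (removals (x ∷ xs))) ℕ.+ 2 ℕ.* 𝟙∈² a b (x ∷ xs) ≡ 𝟙∈² a b (x ∷ xs) ℕ.* suc n
    by-cases (yes refl) (yes refl) = ⊥-elim (a≢b refl)
    by-cases (yes refl) (no b≢a)   = sum-𝟙∈²-removals-head xs b≢a x∉xs′ !xs
    by-cases (no a≢b′)  (yes refl) = begin
        sum (map (𝟙∈² a b) (removals (b ∷ xs))) ℕ.+ 2 ℕ.* 𝟙∈² a b (b ∷ xs)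
      ≡⟨ cong₂ (λ s p → s ℕ.+ 2 ℕ.* p)
               (cong sum (LP.map-cong (𝟙∈²-comm a b) (removals (b ∷ xs)))) (𝟙∈²-comm a b (b ∷ xs)) ⟩
        sum (map (𝟙∈² b a) (removals (b ∷ xs))) ℕ.+ 2 ℕ.* 𝟙∈² b a (b ∷ xs)
      ≡⟨ sum-𝟙∈²-removals-head xs a≢b′ x∉xs′ !xs ⟩
        𝟙∈² b a (b ∷ xs) ℕ.* suc n
      ≡⟨ cong (ℕ._* suc n) (𝟙∈²-comm b a (b ∷ xs)) ⟩
        𝟙∈² a b (b ∷ xs) ℕ.* suc n
      ∎
    by-cases (no a≢x) (no b≢x) = begin
        p ℕ.+ sum (map (𝟙∈² a b) (map (x ∷_) (removals xs))) ℕ.+ 2 ℕ.* 𝟙∈² a b (x ∷ xs)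
      ≡⟨ cong₂ (λ s p′ → p ℕ.+ s ℕ.+ 2 ℕ.* p′)
               (sum-map-∷ (𝟙∈² a b) (𝟙∈² a b) x (removals xs) 𝟙∈²-∷) (𝟙∈²-∷ xs) ⟩
        p ℕ.+ sum (map (𝟙∈² a b) (removals xs)) ℕ.+ 2 ℕ.* p
      ≡⟨ ℕP.+-assoc p _ _ ⟩
        p ℕ.+ (sum (map (𝟙∈² a b) (removals xs)) ℕ.+ 2 ℕ.* p)
      ≡⟨ cong (p ℕ.+_) (sum-𝟙∈²-removals a≢b !xs) ⟩
        p ℕ.+ p ℕ.* n
      ≡⟨ sym (ℕP.*-suc p n) ⟩
        p ℕ.* suc n
      ≡⟨ cong (ℕ._* suc n) (sym (𝟙∈²-∷ xs)) ⟩
        𝟙∈² a b (x ∷ xs) ℕ.* suc n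
      ∎
      where
      p = 𝟙∈² a b xs
      𝟙∈²-∷ : ∀ R → 𝟙∈² a b (x ∷ R) ≡ 𝟙∈² a b R
      𝟙∈²-∷ R = cong₂ ℕ._*_ (𝟙∈-∷-≢ R a≢x) (𝟙∈-∷-≢ R b≢x)

-- Rational arithmetic

private
  toℚᵘ-frac : ∀ a b → toℚᵘ (frac a (suc b)) ℚᵘ.≃ mkℚᵘ (+ a) b
  toℚᵘ-frac a b = ℚP.toℚᵘ-fromℚᵘ (mkℚᵘ (+ a) b)

  mkℚᵘ-cong : ∀ a b c d → a ℕ.* suc d ≡ c ℕ.* suc b → mkℚᵘ (+ a) b ℚᵘ.≃ mkℚᵘ (+ c) d
  mkℚᵘ-cong a b c d ad≡cb = *≡* (trans (sym (ℤP.pos-* a (suc d))) (trans (cong +_ ad≡cb) (ℤP.pos-* c (suc b))))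

frac-cong : ∀ a b c d → a ℕ.* suc d ≡ c ℕ.* suc b → frac a (suc b) ≡ frac c (suc d)
frac-cong a b c d ad≡cb = ℚP.toℚᵘ-injective
  (ℚᵘP.≃-trans (toℚᵘ-frac a b) (ℚᵘP.≃-trans (mkℚᵘ-cong a b c d ad≡cb) (ℚᵘP.≃-sym (toℚᵘ-frac c d))))

frac-* : ∀ a b c d → frac a (suc b) ℚ.* frac c (suc d) ≡ frac (a ℕ.* c) (suc b ℕ.* suc d)
frac-* a b c d = ℚP.toℚᵘ-injective (begin-equality
    toℚᵘ (frac a (suc b) ℚ.* frac c (suc d))            ≃⟨ ℚP.toℚᵘ-homo-* (frac a (suc b)) (frac c (suc d)) ⟩
    toℚᵘ (frac a (suc b)) ℚᵘ.* toℚᵘ (frac c (suc d))   ≃⟨ ℚᵘP.*-cong (toℚᵘ-frac a b) (toℚᵘ-frac c d) ⟩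
    mkℚᵘ (+ a ℤ.* + c) (d ℕ.+ b ℕ.* suc d)              ≡⟨ cong (λ z → mkℚᵘ z (d ℕ.+ b ℕ.* suc d)) (sym (ℤP.pos-* a c)) ⟩
    mkℚᵘ (+ (a ℕ.* c)) (d ℕ.+ b ℕ.* suc d)              ≃⟨ ℚᵘP.≃-sym (toℚᵘ-frac (a ℕ.* c) (d ℕ.+ b ℕ.* suc d)) ⟩
    toℚᵘ (frac (a ℕ.* c) (suc b ℕ.* suc d))             ∎)
  where open ℚᵘP.≤-Reasoning

frac-+ : ∀ a b c d → frac a (suc b) ℚ.+ frac c (suc d) ≡ frac (a ℕ.* suc d ℕ.+ c ℕ.* suc b) (suc b ℕ.* suc d)
frac-+ a b c d = ℚP.toℚᵘ-injective (begin-equality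
    toℚᵘ (frac a (suc b) ℚ.+ frac c (suc d))            ≃⟨ ℚP.toℚᵘ-homo-+ (frac a (suc b)) (frac c (suc d)) ⟩
    toℚᵘ (frac a (suc b)) ℚᵘ.+ toℚᵘ (frac c (suc d))   ≃⟨ ℚᵘP.+-cong (toℚᵘ-frac a b) (toℚᵘ-frac c d) ⟩
    mkℚᵘ (+ a ℤ.* + suc d ℤ.+ + c ℤ.* + suc b) bd       ≡⟨ cong (λ z → mkℚᵘ z bd) numerator ⟩
    mkℚᵘ (+ (a ℕ.* suc d ℕ.+ c ℕ.* suc b)) bd           ≃⟨ ℚᵘP.≃-sym (toℚᵘ-frac _ bd) ⟩
    toℚᵘ (frac (a ℕ.* suc d ℕ.+ c ℕ.* suc b) (suc b ℕ.* suc d)) ∎)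
  where
  open ℚᵘP.≤-Reasoning
  bd = d ℕ.+ b ℕ.* suc d
  numerator : + a ℤ.* + suc d ℤ.+ + c ℤ.* + suc b ≡ + (a ℕ.* suc d ℕ.+ c ℕ.* suc b)
  numerator = trans (cong₂ ℤ._+_ (sym (ℤP.pos-* a (suc d))) (sym (ℤP.pos-* c (suc b))))
                    (sym (ℤP.pos-+ (a ℕ.* suc d) (c ℕ.* suc b)))

frac-≤ : ∀ a b c d → a ℕ.* suc d ≤ c ℕ.* suc b → frac a (suc b) ℚ.≤ frac c (suc d)
frac-≤ a b c d ad≤cb = ℚP.toℚᵘ-cancel-≤ (begin
    toℚᵘ (frac a (suc b))  ≃⟨ toℚᵘ-frac a b ⟩
    mkℚᵘ (+ a) b           ≤⟨ ℚᵘ.*≤* (subst₂ ℤ._≤_ (ℤP.pos-* a (suc d)) (ℤP.pos-* c (suc b)) (ℤ.+≤+ ad≤cb)) ⟩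
    mkℚᵘ (+ c) d           ≃⟨ ℚᵘP.≃-sym (toℚᵘ-frac c d) ⟩
    toℚᵘ (frac c (suc d))  ∎)
  where open ℚᵘP.≤-Reasoning

frac-self : ∀ b → frac (suc b) (suc b) ≡ 1ℚ
frac-self b = frac-cong (suc b) b 1 0 (trans (ℕP.*-identityʳ (suc b)) (sym (ℕP.*-identityˡ (suc b))))

fromℕ-+ : ∀ a c → fromℕ a ℚ.+ fromℕ c ≡ fromℕ (a ℕ.+ c)
fromℕ-+ a c = trans (frac-+ a 0 c 0) (frac-cong (a ℕ.* 1 ℕ.+ c ℕ.* 1) 0 (a ℕ.+ c) 0 (rearrange a c))
  where
  rearrange : ∀ a c → (a ℕ.* 1 ℕ.+ c ℕ.* 1) ℕ.* 1 ≡ (a ℕ.+ c) ℕ.* 1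
  rearrange = solve-∀

fromℕ-* : ∀ a c → fromℕ a ℚ.* fromℕ c ≡ fromℕ (a ℕ.* c)
fromℕ-* a c = trans (frac-* a 0 c 0) (frac-cong (a ℕ.* c) 0 (a ℕ.* c) 0 refl)

x+y≡z⇒x≡z-y : ∀ x y z → x ℚ.+ y ≡ z → x ≡ z ℚ.- y
x+y≡z⇒x≡z-y x y z x+y≡z = trans (solve 2 (λ x y → x := (x :+ y) :- y) refl x y) (cong (ℚ._- y) x+y≡z)

fromℕ-x+ck≡km : ∀ x k c m → x ℕ.+ c ℕ.* k ≡ k ℕ.* m →
  fromℕ x ≡ fromℕ k ℚ.* fromℕ m ℚ.- fromℕ c ℚ.* fromℕ k
fromℕ-x+ck≡km x k c m x+ck≡km = x+y≡z⇒x≡z-y (fromℕ x) (fromℕ c ℚ.* fromℕ k) (fromℕ k ℚ.* fromℕ m) (begin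
    fromℕ x ℚ.+ fromℕ c ℚ.* fromℕ k  ≡⟨ cong (fromℕ x ℚ.+_) (fromℕ-* c k) ⟩
    fromℕ x ℚ.+ fromℕ (c ℕ.* k)      ≡⟨ fromℕ-+ x (c ℕ.* k) ⟩
    fromℕ (x ℕ.+ c ℕ.* k)            ≡⟨ cong fromℕ x+ck≡km ⟩
    fromℕ (k ℕ.* m)                  ≡⟨ sym (fromℕ-* k m) ⟩
    fromℕ k ℚ.* fromℕ m              ∎)
  where open ≡-Reasoning

1-frac : ∀ c b → c ≤ suc b → 1ℚ ℚ.- frac c (suc b) ≡ frac (suc b ∸ c) (suc b)
1-frac c b c≤1+b = sym (x+y≡z⇒x≡z-y _ _ 1ℚ (trans (frac-+ (suc b ∸ c) b c b)
  (frac-cong ((suc b ∸ c) ℕ.* suc b ℕ.+ c ℕ.* suc b) (b ℕ.+ b ℕ.* suc b) 1 0 sum≡square)))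
  where
  open ≡-Reasoning
  sum≡square : ((suc b ∸ c) ℕ.* suc b ℕ.+ c ℕ.* suc b) ℕ.* 1 ≡ 1 ℕ.* (suc b ℕ.* suc b)
  sum≡square = begin
      ((suc b ∸ c) ℕ.* suc b ℕ.+ c ℕ.* suc b) ℕ.* 1  ≡⟨ ℕP.*-identityʳ _ ⟩
      (suc b ∸ c) ℕ.* suc b ℕ.+ c ℕ.* suc b          ≡⟨ ℕP.*-distribʳ-+ (suc b) (suc b ∸ c) c ⟨
      (suc b ∸ c ℕ.+ c) ℕ.* suc b                    ≡⟨ cong (ℕ._* suc b) (ℕP.m∸n+n≡m c≤1+b) ⟩
      suc b ℕ.* suc b                                ≡⟨ ℕP.*-identityˡ _ ⟨
      1 ℕ.* (suc b ℕ.* suc b)                        ∎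

sumℚ : List ℚ → ℚ
sumℚ = Data.List.foldr ℚ._+_ 0ℚ

sumℚ-fromℕ : ∀ {B : Set} (k : B → ℕ) (xs : List B) → sumℚ (map (fromℕ ∘ k) xs) ≡ fromℕ (sum (map k xs))
sumℚ-fromℕ k []       = refl
sumℚ-fromℕ k (x ∷ xs) = trans (cong (fromℕ (k x) ℚ.+_) (sumℚ-fromℕ k xs)) (fromℕ-+ (k x) (sum (map k xs)))

sumℚ-const : ∀ {B : Set} (f : B → ℚ) (κ : ℚ) (xs : List B) → (∀ {x} → x ∈ xs → f x ≡ κ) →
  sumℚ (map f xs) ≡ fromℕ (length xs) ℚ.* κ
sumℚ-const f κ []       _    = sym (ℚP.*-zeroˡ κ)
sumℚ-const f κ (x ∷ xs) f≡κ = begin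
    f x ℚ.+ sumℚ (map f xs)                  ≡⟨ cong₂ ℚ._+_ (f≡κ (here refl)) (sumℚ-const f κ xs (f≡κ ∘ there)) ⟩
    κ ℚ.+ fromℕ (length xs) ℚ.* κ             ≡⟨ solve 2 (λ k l → k :+ l :* k := (con 1ℚ :+ l) :* k) refl κ (fromℕ (length xs)) ⟩
    (1ℚ ℚ.+ fromℕ (length xs)) ℚ.* κ          ≡⟨ cong (ℚ._* κ) (fromℕ-+ 1 (length xs)) ⟩
    fromℕ (suc (length xs)) ℚ.* κ             ∎
  where open ≡-Reasoning

frac≤1 : ∀ {a b} → a ≤ b → frac a b ℚ.≤ 1ℚ
frac≤1 {a} {zero}  _   = frac-≤ 0 0 1 0 z≤n
frac≤1 {a} {suc b} a≤b = frac-≤ a b 1 0 (subst₂ _≤_ (sym (ℕP.*-identityʳ a)) (sym (ℕP.*-identityˡ (suc b))) a≤b)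

-- Expectations

module _ {A : Set} where

  mass : Dist A → ℚ
  mass d = 𝔼 d (λ _ → 1ℚ)

  𝔼-++ : (d d′ : Dist A) (f : A → ℚ) → 𝔼 (d ++ d′) f ≡ 𝔼 d f ℚ.+ 𝔼 d′ f
  𝔼-++ []             d′ f = sym (ℚP.+-identityˡ _)
  𝔼-++ ((p , x) ∷ d) d′ f =
    trans (cong (p ℚ.* f x ℚ.+_) (𝔼-++ d d′ f)) (sym (ℚP.+-assoc (p ℚ.* f x) (𝔼 d f) (𝔼 d′ f)))

  𝔼-scale : (c : ℚ) (d : Dist A) (f : A → ℚ) →
    𝔼 (map (λ qy → (c ℚ.* proj₁ qy , proj₂ qy)) d) f ≡ c ℚ.* 𝔼 d f
  𝔼-scale c []             f = sym (ℚP.*-zeroʳ c)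
  𝔼-scale c ((q , y) ∷ d) f = trans (cong ((c ℚ.* q) ℚ.* f y ℚ.+_) (𝔼-scale c d f))
    (solve 4 (λ c q v r → (c :* q) :* v :+ c :* r := c :* (q :* v :+ r)) refl c q (f y) (𝔼 d f))

  𝔼-uniform : ∀ {B : Set} (w : ℚ) (F : B → A) (xs : List B) (f : A → ℚ) →
    𝔼 (map (λ x → (w , F x)) xs) f ≡ w ℚ.* sumℚ (map (f ∘ F) xs)
  𝔼-uniform w F []       f = sym (ℚP.*-zeroʳ w)
  𝔼-uniform w F (x ∷ xs) f = trans (cong (w ℚ.* f (F x) ℚ.+_) (𝔼-uniform w F xs f)) (sym (ℚP.*-distribˡ-+ w _ _))

  𝔼-cong : (d : Dist A) {f g : A → ℚ} → All (λ px → f (proj₂ px) ≡ g (proj₂ px)) d → 𝔼 d f ≡ 𝔼 d g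
  𝔼-cong []             []              = refl
  𝔼-cong ((p , x) ∷ d) (fx≡gx ∷ f≡g) = cong₂ (λ a b → p ℚ.* a ℚ.+ b) fx≡gx (𝔼-cong d f≡g)

  𝔼-+ : (d : Dist A) (f g : A → ℚ) → 𝔼 d (λ x → f x ℚ.+ g x) ≡ 𝔼 d f ℚ.+ 𝔼 d g
  𝔼-+ []             f g = refl
  𝔼-+ ((p , x) ∷ d) f g = trans (cong (p ℚ.* (f x ℚ.+ g x) ℚ.+_) (𝔼-+ d f g))
    (solve 5 (λ p a b r s → p :* (a :+ b) :+ (r :+ s) := (p :* a :+ r) :+ (p :* b :+ s))
           refl p (f x) (g x) (𝔼 d f) (𝔼 d g))

  𝔼-*ˡ : (c : ℚ) (d : Dist A) (f : A → ℚ) → 𝔼 d (λ x → c ℚ.* f x) ≡ c ℚ.* 𝔼 d f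
  𝔼-*ˡ c []             f = sym (ℚP.*-zeroʳ c)
  𝔼-*ˡ c ((p , x) ∷ d) f = trans (cong (p ℚ.* (c ℚ.* f x) ℚ.+_) (𝔼-*ˡ c d f))
    (solve 4 (λ c p v r → p :* (c :* v) :+ c :* r := c :* (p :* v :+ r)) refl c p (f x) (𝔼 d f))

  𝔼-*ʳ : (c : ℚ) (d : Dist A) (f : A → ℚ) → 𝔼 d (λ x → f x ℚ.* c) ≡ c ℚ.* 𝔼 d f
  𝔼-*ʳ c d f = trans (𝔼-cong d (All.universal (λ px → ℚP.*-comm (f (proj₂ px)) c) d)) (𝔼-*ˡ c d f)

  𝔼-const : (c : ℚ) (d : Dist A) → 𝔼 d (λ _ → c) ≡ c ℚ.* mass d
  𝔼-const c d = trans (𝔼-cong d (All.universal (λ _ → sym (ℚP.*-identityʳ c)) d)) (𝔼-*ˡ c d (λ _ → 1ℚ))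

  𝔼-sumℚ : ∀ {B : Set} (d : Dist A) (xs : List B) (h : B → A → ℚ) →
    𝔼 d (λ s → sumℚ (map (λ x → h x s) xs)) ≡ sumℚ (map (λ x → 𝔼 d (h x)) xs)
  𝔼-sumℚ d []       h = trans (𝔼-const 0ℚ d) (ℚP.*-zeroˡ (mass d))
  𝔼-sumℚ d (x ∷ xs) h = trans (𝔼-+ d (h x) _) (cong (𝔼 d (h x) ℚ.+_) (𝔼-sumℚ d xs h))

module _ {A B : Set} where

  𝔼->>= : (d : Dist A) (k : A → Dist B) (f : B → ℚ) → 𝔼 (d >>= k) f ≡ 𝔼 d (λ x → 𝔼 (k x) f)
  𝔼->>= []             k f = refl
  𝔼->>= ((p , x) ∷ d) k f = trans (𝔼-++ (map (λ qy → (p ℚ.* proj₁ qy , proj₂ qy)) (k x)) (d >>= k) f)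
    (cong₂ ℚ._+_ (𝔼-scale p (k x) f) (𝔼->>= d k f))

  All->>= : {P : B → Set} (d : Dist A) (k : A → Dist B) →
    All (λ px → All (P ∘ proj₂) (k (proj₂ px))) d → All (P ∘ proj₂) (d >>= k)
  All->>= []             k []         = []
  All->>= ((p , x) ∷ d) k (Pk ∷ Pks) = AllP.++⁺ (AllP.map⁺ Pk) (All->>= d k Pks)

≈ₑ-refl : ∀ {e} → e ≈ₑ e
≈ₑ-refl = inj₁ (refl , refl)

≈ₑ-sym : ∀ {e f} → e ≈ₑ f → f ≈ₑ e
≈ₑ-sym (inj₁ (refl , refl)) = inj₁ (refl , refl)
≈ₑ-sym (inj₂ (refl , refl)) = inj₂ (refl , refl)

≈ₑ-trans : ∀ {e f g} → e ≈ₑ f → f ≈ₑ g → e ≈ₑ g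
≈ₑ-trans (inj₁ (refl , refl)) f≈g                  = f≈g
≈ₑ-trans (inj₂ (refl , refl)) (inj₁ (refl , refl)) = inj₂ (refl , refl)
≈ₑ-trans (inj₂ (refl , refl)) (inj₂ (refl , refl)) = inj₁ (refl , refl)

≈ₑ-flip : ∀ {e x y} → e ≈ₑ (x , y) → e ≈ₑ (y , x)
≈ₑ-flip (inj₁ eq) = inj₂ eq
≈ₑ-flip (inj₂ eq) = inj₁ eq

≈ₑ-cancelʳ : ∀ {x y w} → (x , w) ≈ₑ (y , w) → x ≡ y
≈ₑ-cancelʳ (inj₁ (x≡y , _))   = x≡y
≈ₑ-cancelʳ (inj₂ (x≡w , w≡y)) = trans x≡w w≡y

Adj-sym : ∀ {E x y} → Adj E x y → Adj E y x
Adj-sym (here e≈xy)  = here (≈ₑ-flip e≈xy)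
Adj-sym (there adj) = there (Adj-sym adj)

Adj-mono : ∀ {E F x y} → E ⊆ F → Adj E x y → Adj F x y
Adj-mono E⊆F adj with find adj
... | _ , e∈E , e≈xy = lose (E⊆F e∈E) e≈xy

Adj-++⁺ : ∀ {E e x y} → Adj E x y → Adj (E ++ [ e ]) x y
Adj-++⁺ = Adj-mono MP.∈-++⁺ˡ

Adj-++⁻ : ∀ {E e x y} → Adj (E ++ [ e ]) x y → Adj E x y ⊎ e ≈ₑ (x , y)
Adj-++⁻ {[]}    (here e≈xy)  = inj₂ e≈xy
Adj-++⁻ {_ ∷ E} (here f≈xy)  = inj₁ (here f≈xy)
Adj-++⁻ {_ ∷ E} (there adj) = Sum.map₁ there (Adj-++⁻ {E} adj)

Adj-last : ∀ {E x y} → Adj (E ++ [ (x , y) ]) x y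
Adj-last {E} = lose (MP.∈-++⁺ʳ E (here refl)) ≈ₑ-refl

Loopless : List Edge → Set
Loopless = All (λ e → proj₁ e ≢ proj₂ e)

Adj⇒≢ : ∀ {E} → Loopless E → ∀ {x y} → Adj E x y → x ≢ y
Adj⇒≢ loopless adj with find adj
... | _ , e∈E , inj₁ (refl , refl) = All.lookup loopless e∈E
... | _ , e∈E , inj₂ (refl , refl) = All.lookup loopless e∈E ∘ sym

Simple : List Edge → Set
Simple = AllPairs (λ e f → ¬ (e ≈ₑ f))

Simple-≈ₑ⇒≡ : ∀ {σ} → Simple σ → ∀ {e f} → e ∈ σ → f ∈ σ → e ≈ₑ f → e ≡ f
Simple-≈ₑ⇒≡ (_ ∷ _)     (here refl)  (here refl)  _   = refl
Simple-≈ₑ⇒≡ (e≉ ∷ _)    (here refl)  (there f∈σ) e≈f = ⊥-elim (All.lookup e≉ f∈σ e≈f)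
Simple-≈ₑ⇒≡ (f≉ ∷ _)    (there e∈σ) (here refl)  e≈f = ⊥-elim (All.lookup f≉ e∈σ (≈ₑ-sym e≈f))
Simple-≈ₑ⇒≡ (_ ∷ simple) (there e∈σ) (there f∈σ) e≈f = Simple-≈ₑ⇒≡ simple e∈σ f∈σ e≈f

Simple⇒Unique : ∀ {σ} → Simple σ → Unique σ
Simple⇒Unique []             = []
Simple⇒Unique (e≉ ∷ simple) = All.map (λ e≉f e≡f → e≉f (subst (_ ≈ₑ_) e≡f ≈ₑ-refl)) e≉ ∷ Simple⇒Unique simple

ValidStream-init : ∀ σ {e} → ValidStream (σ ++ [ e ]) → ValidStream σ
ValidStream-init σ (loopless , simple) = AllP.++⁻ˡ σ loopless , AllPairs-init σ simple

Adj⇒∈endpoints : ∀ {E x y} → Adj E x y → x ∈ endpoints E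
Adj⇒∈endpoints adj with find adj
... | _ , e∈E , inj₁ (refl , refl) = MP.∈-deduplicate⁺ ℕ._≟_ (MP.∈-concatMap⁺ _ (lose e∈E (here refl)))
... | _ , e∈E , inj₂ (refl , refl) = MP.∈-deduplicate⁺ ℕ._≟_ (MP.∈-concatMap⁺ _ (lose e∈E (there (here refl))))

endpoints-mono : ∀ {E F} → E ⊆ F → endpoints E ⊆ endpoints F
endpoints-mono {E} E⊆F x∈ with find (MP.∈-concatMap⁻ _ {xs = E} (MP.∈-deduplicate⁻ ℕ._≟_ _ x∈))
... | _ , e∈E , x∈e = MP.∈-deduplicate⁺ ℕ._≟_ (MP.∈-concatMap⁺ _ (lose (E⊆F e∈E) x∈e))

endpoints-unique : ∀ E → Unique (endpoints E)
endpoints-unique E = UDP.deduplicate-! ℕ._≟_ _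

Triple : Set
Triple = ℕ × ℕ × ℕ

∈-triples⁺ : ∀ {V x y z} → x ∈ V → y ∈ V → z ∈ V → (x , y , z) ∈ triples V
∈-triples⁺ x∈V y∈V z∈V = MP.∈-concatMap⁺ _ (lose x∈V (MP.∈-concatMap⁺ _ (lose y∈V (MP.∈-map⁺ _ z∈V))))

∈-triples⁻ : ∀ {V x y z} → (x , y , z) ∈ triples V → x ∈ V × y ∈ V × z ∈ V
∈-triples⁻ {V} t∈ with find (MP.∈-concatMap⁻ _ {xs = V} t∈)
... | _ , x∈V , t∈′ with find (MP.∈-concatMap⁻ _ {xs = V} t∈′)
... | _ , y∈V , t∈″ with MP.∈-map⁻ _ t∈″
... | _ , z∈V , refl = x∈V , y∈V , z∈V

triples-unique : ∀ {V} → Unique V → Unique (triples V)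
triples-unique {V} !V = Unique-concatMap⁺ _ !V
  (λ x → Unique-concatMap⁺ _ !V (λ y → UP.map⁺ (λ { refl → refl }) !V) same-second)
  same-first
  where
  same-second : ∀ {x y y′ t} → t ∈ map (λ z → (x , y , z)) V → t ∈ map (λ z → (x , y′ , z)) V → y ≡ y′
  same-second t∈ t∈′ with MP.∈-map⁻ _ t∈ | MP.∈-map⁻ _ t∈′
  ... | _ , _ , refl | _ , _ , refl = refl
  first : ∀ {x t} → t ∈ concatMap (λ y → map (λ z → (x , y , z)) V) V → proj₁ t ≡ x
  first {x} t∈ with find (MP.∈-concatMap⁻ _ {xs = V} t∈)
  ... | _ , _ , t∈′ with MP.∈-map⁻ _ t∈′
  ... | _ , _ , refl = refl
  same-first : ∀ {x x′ t} → t ∈ concatMap (λ y → map (λ z → (x , y , z)) V) V →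
    t ∈ concatMap (λ y → map (λ z → (x′ , y , z)) V) V → x ≡ x′
  same-first t∈ t∈′ = trans (sym (first t∈)) (first t∈′)

∈-nbrs⁻ : ∀ S u {w} → w ∈ nbrs S u → Adj S u w
∈-nbrs⁻ ((a , b) ∷ S) u w∈ with a ℕ.≟ u | b ℕ.≟ u
... | yes refl | _        =
  Sum.[ (λ { (here refl) → here (inj₁ (refl , refl)) }) , there ∘ ∈-nbrs⁻ S u ] (MP.∈-++⁻ [ b ] w∈)
... | no _     | yes refl =
  Sum.[ (λ { (here refl) → here (inj₂ (refl , refl)) }) , there ∘ ∈-nbrs⁻ S u ] (MP.∈-++⁻ [ a ] w∈)
... | no _     | no _     = there (∈-nbrs⁻ S u w∈)

∈-nbrs⁺ : ∀ S u {w} → Adj S u w → w ∈ nbrs S u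
∈-nbrs⁺ ((a , b) ∷ S) u (here e≈uw) with a ℕ.≟ u | b ℕ.≟ u | e≈uw
... | yes _    | _     | inj₁ (refl , refl) = here refl
... | yes refl | _     | inj₂ (refl , refl) = here refl
... | no a≢u   | _     | inj₁ (refl , refl) = ⊥-elim (a≢u refl)
... | no _     | yes _ | inj₂ (refl , refl) = here refl
... | no _     | no b≢u | inj₂ (refl , refl) = ⊥-elim (b≢u refl)
∈-nbrs⁺ ((a , b) ∷ S) u (there adj) with a ℕ.≟ u | b ℕ.≟ u
... | yes _ | _     = there (∈-nbrs⁺ S u adj)
... | no _  | yes _ = there (∈-nbrs⁺ S u adj)
... | no _  | no _  = ∈-nbrs⁺ S u adj

∈-commonNbrs⁻ : ∀ S u v {w} → w ∈ commonNbrs S u v → Adj S u w × Adj S v w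
∈-commonNbrs⁻ S u v w∈ with MP.∈-filter⁻ (Adj? S v) (MP.∈-deduplicate⁻ ℕ._≟_ (filter (Adj? S v) (nbrs S u)) w∈)
... | w∈nbrs , adj-vw = ∈-nbrs⁻ S u w∈nbrs , adj-vw

∈-commonNbrs⁺ : ∀ S u v {w} → Adj S u w → Adj S v w → w ∈ commonNbrs S u v
∈-commonNbrs⁺ S u v adj-uw adj-vw = MP.∈-deduplicate⁺ ℕ._≟_ (MP.∈-filter⁺ (Adj? S v) (∈-nbrs⁺ S u adj-uw) adj-vw)

commonNbrs-unique : ∀ S u v → Unique (commonNbrs S u v)
commonNbrs-unique S u v = UDP.deduplicate-! ℕ._≟_ _

_≟ₑ_ : DecidableEquality Edge
_≟ₑ_ = ≡-dec ℕ._≟_ ℕ._≟_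

open MembershipCount _≟ₑ_

length-commonNbrs-⊆ : ∀ σ S u v → S ⊆ σ →
  length (commonNbrs S u v) ≡ sum (map (λ w → 𝟙 (Adj? S u w) ℕ.* 𝟙 (Adj? S v w)) (commonNbrs σ u v))
length-commonNbrs-⊆ σ S u v S⊆σ = begin
    length (commonNbrs S u v)
  ≡⟨ ⊆⊇⇒length≡ (commonNbrs-unique S u v) (UP.filter⁺ common? (commonNbrs-unique σ u v)) narrow widen ⟩
    length (filter common? W)
  ≡⟨ sum-𝟙≡length-filter common? W ⟨
    sum (map (𝟙 ∘ common?) W)
  ≡⟨ cong sum (LP.map-cong (λ w → 𝟙-× (Adj? S u w) (Adj? S v w)) W) ⟩
    sum (map (λ w → 𝟙 (Adj? S u w) ℕ.* 𝟙 (Adj? S v w)) W)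
  ∎
  where
  open ≡-Reasoning
  W = commonNbrs σ u v
  common? : Decidable (λ w → Adj S u w × Adj S v w)
  common? w = Adj? S u w ×-dec Adj? S v w
  narrow : commonNbrs S u v ⊆ filter common? W
  narrow w∈ with ∈-commonNbrs⁻ S u v w∈
  ... | uw , vw = MP.∈-filter⁺ common? (∈-commonNbrs⁺ σ u v (Adj-mono S⊆σ uw) (Adj-mono S⊆σ vw)) (uw , vw)
  widen : filter common? W ⊆ commonNbrs S u v
  widen w∈ with MP.∈-filter⁻ common? {xs = W} w∈
  ... | _ , (uw , vw) = ∈-commonNbrs⁺ S u v uw vw

𝟙Adj≡𝟙∈ : ∀ {σ S} → Simple σ → S ⊆ σ → ∀ {a x y} → a ∈ σ → a ≈ₑ (x , y) →
  𝟙 (Adj? S x y) ≡ 𝟙∈ a S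
𝟙Adj≡𝟙∈ {σ} {S} simple S⊆σ {a} {x} {y} a∈σ a≈xy = 𝟙-cong (Adj? S x y) _ a∈S (λ a∈S → lose a∈S a≈xy)
  where
  a∈S : Adj S x y → a ∈ S
  a∈S adj with find adj
  ... | f , f∈S , f≈xy = subst (_∈ S) (Simple-≈ₑ⇒≡ simple (S⊆σ f∈S) a∈σ (≈ₑ-trans f≈xy (≈ₑ-sym a≈xy))) f∈S

-- Triangles

_∈₃_ : ℕ → Triple → Set
n ∈₃ (x , y , z) = n ≡ x ⊎ n ≡ y ⊎ n ≡ z

SameVertices : Triple → Triple → Set
SameVertices t t′ = ∀ n → (n ∈₃ t → n ∈₃ t′) × (n ∈₃ t′ → n ∈₃ t)

Increasing : Triple → Set
Increasing (x , y , z) = x < y × y < z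

SameVertices-refl : ∀ {t} → SameVertices t t
SameVertices-refl n = id , id

SameVertices-sym : ∀ {t t′} → SameVertices t t′ → SameVertices t′ t
SameVertices-sym t∼t′ n = proj₂ (t∼t′ n) , proj₁ (t∼t′ n)

SameVertices-trans : ∀ {t t′ t″} → SameVertices t t′ → SameVertices t′ t″ → SameVertices t t″
SameVertices-trans t∼t′ t′∼t″ n = proj₁ (t′∼t″ n) ∘ proj₁ (t∼t′ n) , proj₂ (t∼t′ n) ∘ proj₂ (t′∼t″ n)

SameVertices-swap₁₂ : ∀ {x y z} → SameVertices (x , y , z) (y , x , z)
SameVertices-swap₁₂ n = swap , swap
  where
  swap : ∀ {a b c} → n ∈₃ (a , b , c) → n ∈₃ (b , a , c)
  swap (inj₁ n≡a)        = inj₂ (inj₁ n≡a)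
  swap (inj₂ (inj₁ n≡b)) = inj₁ n≡b
  swap (inj₂ (inj₂ n≡c)) = inj₂ (inj₂ n≡c)

SameVertices-swap₂₃ : ∀ {x y z} → SameVertices (x , y , z) (x , z , y)
SameVertices-swap₂₃ n = swap , swap
  where
  swap : ∀ {a b c} → n ∈₃ (a , b , c) → n ∈₃ (a , c , b)
  swap (inj₁ n≡a)        = inj₁ n≡a
  swap (inj₂ (inj₁ n≡b)) = inj₂ (inj₂ n≡b)
  swap (inj₂ (inj₂ n≡c)) = inj₂ (inj₁ n≡c)

Increasing-unique : ∀ {t t′} → Increasing t → Increasing t′ → SameVertices t t′ → t ≡ t′
Increasing-unique {x , y , z} {x′ , y′ , z′} (x<y , y<z) (x′<y′ , y′<z′) t∼t′ =
  cong₂ _,_ x≡x′ (cong₂ _,_ y≡y′ z≡z′)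
  where
  least : ∀ {a b c n} → a < b → b < c → n ∈₃ (a , b , c) → a ≤ n
  least a<b b<c (inj₁ refl)        = ℕP.≤-refl
  least a<b b<c (inj₂ (inj₁ refl)) = ℕP.<⇒≤ a<b
  least a<b b<c (inj₂ (inj₂ refl)) = ℕP.<⇒≤ (ℕP.<-trans a<b b<c)
  greatest : ∀ {a b c n} → a < b → b < c → n ∈₃ (a , b , c) → n ≤ c
  greatest a<b b<c (inj₁ refl)        = ℕP.<⇒≤ (ℕP.<-trans a<b b<c)
  greatest a<b b<c (inj₂ (inj₁ refl)) = ℕP.<⇒≤ b<c
  greatest a<b b<c (inj₂ (inj₂ refl)) = ℕP.≤-refl
  x≡x′ : x ≡ x′
  x≡x′ = ℕP.≤-antisym (least x<y y<z (proj₂ (t∼t′ x′) (inj₁ refl)))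
                      (least x′<y′ y′<z′ (proj₁ (t∼t′ x) (inj₁ refl)))
  z≡z′ : z ≡ z′
  z≡z′ = ℕP.≤-antisym (greatest x′<y′ y′<z′ (proj₁ (t∼t′ z) (inj₂ (inj₂ refl))))
                      (greatest x<y y<z (proj₂ (t∼t′ z′) (inj₂ (inj₂ refl))))
  y≡y′ : y ≡ y′
  y≡y′ with proj₁ (t∼t′ y) (inj₂ (inj₁ refl))
  ... | inj₁ y≡x′        = ⊥-elim (ℕP.<⇒≢ x<y (trans x≡x′ (sym y≡x′)))
  ... | inj₂ (inj₁ y≡y′) = y≡y′
  ... | inj₂ (inj₂ y≡z′) = ⊥-elim (ℕP.<⇒≢ y<z (trans y≡z′ (sym z≡z′)))

sort₂ : ℕ → ℕ → ℕ × ℕ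
sort₂ b c with b ℕ.≤? c
... | yes _ = b , c
... | no _  = c , b

insert₃ : ℕ → ℕ × ℕ → Triple
insert₃ a (p , q) with a ℕ.≤? p
... | yes _ = a , p , q
... | no _ with a ℕ.≤? q
...   | yes _ = p , a , q
...   | no _  = p , q , a

sort₃ : ℕ → ℕ → ℕ → Triple
sort₃ a b c = insert₃ a (sort₂ b c)

sort₂-correct : ∀ b c → b ≢ c →
  proj₁ (sort₂ b c) < proj₂ (sort₂ b c) × (sort₂ b c ≡ (b , c) ⊎ sort₂ b c ≡ (c , b))
sort₂-correct b c b≢c with b ℕ.≤? c
... | yes b≤c = ℕP.≤∧≢⇒< b≤c b≢c , inj₁ refl
... | no b≰c  = ℕP.≰⇒> b≰c , inj₂ refl

insert₃-correct : ∀ a p q → p < q → a ≢ p → a ≢ q →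
  Increasing (insert₃ a (p , q)) × SameVertices (insert₃ a (p , q)) (a , p , q)
insert₃-correct a p q p<q a≢p a≢q with a ℕ.≤? p
... | yes a≤p = (ℕP.≤∧≢⇒< a≤p a≢p , p<q) , SameVertices-refl
... | no a≰p with a ℕ.≤? q
...   | yes a≤q = (ℕP.≰⇒> a≰p , ℕP.≤∧≢⇒< a≤q a≢q) , SameVertices-swap₁₂
...   | no a≰q  = (p<q , ℕP.≰⇒> a≰q) , SameVertices-sym (SameVertices-trans SameVertices-swap₁₂ SameVertices-swap₂₃)

sort₃-correct : ∀ a b c → a ≢ b → b ≢ c → a ≢ c →
  Increasing (sort₃ a b c) × SameVertices (sort₃ a b c) (a , b , c)
sort₃-correct a b c a≢b b≢c a≢c with sort₂ b c | sort₂-correct b c b≢c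
... | _ | p<q , inj₁ refl = insert₃-correct a b c p<q a≢b a≢c
... | _ | p<q , inj₂ refl =
  proj₁ correct , SameVertices-trans (proj₂ correct) SameVertices-swap₂₃
  where correct = insert₃-correct a c b p<q a≢c a≢b

Adj-among₃ : ∀ {F a b c n m} → Adj F a b → Adj F a c → Adj F b c →
  n ∈₃ (a , b , c) → m ∈₃ (a , b , c) → n ≢ m → Adj F n m
Adj-among₃ ab ac bc (inj₁ refl)        (inj₁ refl)        n≢m = ⊥-elim (n≢m refl)
Adj-among₃ ab ac bc (inj₁ refl)        (inj₂ (inj₁ refl)) _   = ab
Adj-among₃ ab ac bc (inj₁ refl)        (inj₂ (inj₂ refl)) _   = ac
Adj-among₃ ab ac bc (inj₂ (inj₁ refl)) (inj₁ refl)        _   = Adj-sym ab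
Adj-among₃ ab ac bc (inj₂ (inj₁ refl)) (inj₂ (inj₁ refl)) n≢m = ⊥-elim (n≢m refl)
Adj-among₃ ab ac bc (inj₂ (inj₁ refl)) (inj₂ (inj₂ refl)) _   = bc
Adj-among₃ ab ac bc (inj₂ (inj₂ refl)) (inj₁ refl)        _   = Adj-sym ac
Adj-among₃ ab ac bc (inj₂ (inj₂ refl)) (inj₂ (inj₁ refl)) _   = Adj-sym bc
Adj-among₃ ab ac bc (inj₂ (inj₂ refl)) (inj₂ (inj₂ refl)) n≢m = ⊥-elim (n≢m refl)

IsTriangle⇒Adj : ∀ {F t n m} → IsTriangle F t → n ∈₃ t → m ∈₃ t → n ≢ m → Adj F n m
IsTriangle⇒Adj (_ , (xy , yz , zx)) = Adj-among₃ xy (Adj-sym zx) yz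

Adj⇒IsTriangle : ∀ {F t a b c} → Increasing t → SameVertices t (a , b , c) →
  Adj F a b → Adj F a c → Adj F b c → IsTriangle F t
Adj⇒IsTriangle {t = x , y , z} (x<y , y<z) t∼abc ab ac bc =
  (x<y , y<z) , ( Adj-among₃ ab ac bc (into (inj₁ refl)) (into (inj₂ (inj₁ refl))) (ℕP.<⇒≢ x<y)
                , Adj-among₃ ab ac bc (into (inj₂ (inj₁ refl))) (into (inj₂ (inj₂ refl))) (ℕP.<⇒≢ y<z)
                , Adj-among₃ ab ac bc (into (inj₂ (inj₂ refl))) (into (inj₁ refl)) (ℕP.<⇒≢ (ℕP.<-trans x<y y<z) ∘ sym))
  where
  into : ∀ {n} → n ∈₃ (x , y , z) → n ∈₃ _
  into {n} = proj₁ (t∼abc n)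

IsTriangle⇒∈triples : ∀ {E t} → IsTriangle E t → t ∈ triples (endpoints E)
IsTriangle⇒∈triples (_ , (xy , yz , zx)) = ∈-triples⁺ (Adj⇒∈endpoints xy) (Adj⇒∈endpoints yz) (Adj⇒∈endpoints zx)

numTriangles-over : ∀ E {V} → Unique V → endpoints E ⊆ V →
  numTriangles E ≡ length (filter (IsTriangle? E) (triples V))
numTriangles-over E {V} !V ends⊆V =
  ⊆⊇⇒length≡ (UP.filter⁺ (IsTriangle? E) (triples-unique (endpoints-unique E)))
             (UP.filter⁺ (IsTriangle? E) (triples-unique !V)) widen narrow
  where
  widen : filter (IsTriangle? E) (triples (endpoints E)) ⊆ filter (IsTriangle? E) (triples V)
  widen t∈ with MP.∈-filter⁻ (IsTriangle? E) {xs = triples (endpoints E)} t∈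
  ... | t∈triples , tri with ∈-triples⁻ t∈triples
  ...   | x∈ , y∈ , z∈ = MP.∈-filter⁺ (IsTriangle? E) (∈-triples⁺ (ends⊆V x∈) (ends⊆V y∈) (ends⊆V z∈)) tri
  narrow : filter (IsTriangle? E) (triples V) ⊆ filter (IsTriangle? E) (triples (endpoints E))
  narrow t∈ with MP.∈-filter⁻ (IsTriangle? E) {xs = triples V} t∈
  ... | _ , tri = MP.∈-filter⁺ (IsTriangle? E) (IsTriangle⇒∈triples tri) tri

-- The triangles closed by (u , v) are the {u , v , w} with w ∈ N_{u,v}, and w ↦ sort₃ u v w is a bijection onto them.

module NewTriangles (σ : List Edge) (u v : ℕ) (valid : ValidStream (σ ++ [ (u , v) ])) where

  private
    σ′ : List Edge
    σ′ = σ ++ [ (u , v) ]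

    V : List ℕ
    V = endpoints σ′

    W : List ℕ
    W = commonNbrs σ u v

    u≢v : u ≢ v
    u≢v = All.lookup (proj₁ valid) (MP.∈-++⁺ʳ σ (here refl))

    loopless : Loopless σ
    loopless = AllP.++⁻ˡ σ (proj₁ valid)

    ¬Adj-uv : ¬ Adj σ u v
    ¬Adj-uv adj with find adj
    ... | _ , e∈σ , e≈uv = AllPairs-last σ (proj₂ valid) e∈σ e≈uv

    New? : Decidable (λ t → IsTriangle σ′ t × ¬ IsTriangle σ t)
    New? t = IsTriangle? σ′ t ×-dec ¬? (IsTriangle? σ t)

    new : List Triple
    new = filter New? (triples V)

    triangle : ℕ → Triple
    triangle w = sort₃ u v w

    ∈W⇒apex : ∀ {w} → w ∈ W → Adj σ u w × Adj σ v w × w ≢ u × w ≢ v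
    ∈W⇒apex w∈W with ∈-commonNbrs⁻ σ u v w∈W
    ... | uw , vw = uw , vw , Adj⇒≢ loopless uw ∘ sym , Adj⇒≢ loopless vw ∘ sym

    triangle-correct : ∀ {w} → w ≢ u → w ≢ v → Increasing (triangle w) × SameVertices (triangle w) (u , v , w)
    triangle-correct w≢u w≢v = sort₃-correct u v _ u≢v (w≢v ∘ sym) (w≢u ∘ sym)

    ∈₃⇒∈V : ∀ {w n} → Adj σ u w → n ∈₃ (u , v , w) → n ∈ V
    ∈₃⇒∈V _  (inj₁ refl)        = Adj⇒∈endpoints (Adj-last {σ})
    ∈₃⇒∈V _  (inj₂ (inj₁ refl)) = Adj⇒∈endpoints (Adj-sym (Adj-last {σ}))
    ∈₃⇒∈V uw (inj₂ (inj₂ refl)) = Adj⇒∈endpoints (Adj-sym (Adj-++⁺ {σ} uw))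

    triangle-new : ∀ {w} → w ∈ W → triangle w ∈ new
    triangle-new {w} w∈W with ∈W⇒apex w∈W
    ... | uw , vw , w≢u , w≢v with triangle-correct w≢u w≢v
    ...   | increasing , t∼uvw =
      MP.∈-filter⁺ New? (∈-triples⁺ (∈₃⇒∈V uw (vertex (inj₁ refl))) (∈₃⇒∈V uw (vertex (inj₂ (inj₁ refl))))
                                     (∈₃⇒∈V uw (vertex (inj₂ (inj₂ refl)))))
        ( Adj⇒IsTriangle increasing t∼uvw (Adj-last {σ}) (Adj-++⁺ {σ} uw) (Adj-++⁺ {σ} vw)
        , λ tri → ¬Adj-uv (IsTriangle⇒Adj tri (proj₂ (t∼uvw u) (inj₁ refl)) (proj₂ (t∼uvw v) (inj₂ (inj₁ refl))) u≢v))
      where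
      vertex : ∀ {n} → n ∈₃ triangle w → n ∈₃ (u , v , w)
      vertex {n} = proj₁ (t∼uvw n)

    -- A new triangle contains the edge (u , v), in one of its three positions and orientations.
    apex-of-new : ∀ {t} → IsTriangle σ′ t → ¬ IsTriangle σ t → ∃[ w ] SameVertices t (u , v , w) × w ≢ u × w ≢ v
    apex-of-new {x , y , z} ((x<y , y<z) , (xy , yz , zx)) old with Adj-++⁻ {σ} xy | Adj-++⁻ {σ} yz | Adj-++⁻ {σ} zx
    ... | inj₁ xy′ | inj₁ yz′ | inj₁ zx′ = ⊥-elim (old ((x<y , y<z) , (xy′ , yz′ , zx′)))
    ... | inj₂ (inj₁ (refl , refl)) | _ | _ =
      z , SameVertices-refl , ℕP.<⇒≢ (ℕP.<-trans x<y y<z) ∘ sym , ℕP.<⇒≢ y<z ∘ sym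
    ... | inj₂ (inj₂ (refl , refl)) | _ | _ =
      z , SameVertices-swap₁₂ , ℕP.<⇒≢ y<z ∘ sym , ℕP.<⇒≢ (ℕP.<-trans x<y y<z) ∘ sym
    ... | inj₁ _ | inj₂ (inj₁ (refl , refl)) | _ =
      x , SameVertices-trans SameVertices-swap₁₂ SameVertices-swap₂₃ , ℕP.<⇒≢ x<y , ℕP.<⇒≢ (ℕP.<-trans x<y y<z)
    ... | inj₁ _ | inj₂ (inj₂ (refl , refl)) | _ =
      x , SameVertices-trans SameVertices-swap₂₃ (SameVertices-trans SameVertices-swap₁₂ SameVertices-swap₂₃) ,
      ℕP.<⇒≢ (ℕP.<-trans x<y y<z) , ℕP.<⇒≢ x<y
    ... | inj₁ _ | inj₁ _ | inj₂ (inj₁ (refl , refl)) =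
      y , SameVertices-trans SameVertices-swap₂₃ SameVertices-swap₁₂ , ℕP.<⇒≢ y<z , ℕP.<⇒≢ x<y ∘ sym
    ... | inj₁ _ | inj₁ _ | inj₂ (inj₂ (refl , refl)) =
      y , SameVertices-swap₂₃ , ℕP.<⇒≢ x<y ∘ sym , ℕP.<⇒≢ y<z

    new⇒apex : ∀ {t} → t ∈ new → ∃[ w ] w ∈ W × SameVertices t (u , v , w)
    new⇒apex t∈new with MP.∈-filter⁻ New? {xs = triples V} t∈new
    ... | _ , (tri , old) with apex-of-new tri old
    ...   | w , t∼uvw , w≢u , w≢v =
      w , ∈-commonNbrs⁺ σ u v (old-edge u (inj₁ refl) w≢u) (old-edge v (inj₂ (inj₁ refl)) w≢v) , t∼uvw
      where
      old-edge : ∀ n → n ∈₃ (u , v , w) → w ≢ n → Adj σ n w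
      old-edge n n∈ w≢n
        with Adj-++⁻ {σ} (IsTriangle⇒Adj tri (proj₂ (t∼uvw n) n∈) (proj₂ (t∼uvw w) (inj₂ (inj₂ refl))) (w≢n ∘ sym))
      ... | inj₁ nw = nw
      ... | inj₂ (inj₁ (_ , v≡w)) = ⊥-elim (w≢v (sym v≡w))
      ... | inj₂ (inj₂ (u≡w , _)) = ⊥-elim (w≢u (sym u≡w))

    triangle-injective : ∀ {w w′} → w ∈ W → w′ ∈ W → triangle w ≡ triangle w′ → w ≡ w′
    triangle-injective w∈W w′∈W eq with ∈W⇒apex w∈W | ∈W⇒apex w′∈W
    ... | _ , _ , w≢u , w≢v | _ , _ , w′≢u , w′≢v
      with proj₁ (SameVertices-trans (SameVertices-sym (proj₂ (triangle-correct w≢u w≢v)))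
                   (subst (λ t → SameVertices t _) (sym eq) (proj₂ (triangle-correct w′≢u w′≢v))) _)
                 (inj₂ (inj₂ refl))
    ... | inj₁ w≡u        = ⊥-elim (w≢u w≡u)
    ... | inj₂ (inj₁ w≡v) = ⊥-elim (w≢v w≡v)
    ... | inj₂ (inj₂ w≡w′) = w≡w′

    new⊆triangles : new ⊆ map triangle W
    new⊆triangles {t} t∈new with new⇒apex t∈new | MP.∈-filter⁻ New? {xs = triples V} t∈new
    ... | w , w∈W , t∼uvw | _ , ((increasing , _) , _) with ∈W⇒apex w∈W
    ...   | _ , _ , w≢u , w≢v =
      subst (_∈ map triangle W)
            (sym (Increasing-unique increasing (proj₁ (triangle-correct w≢u w≢v))
                                    (SameVertices-trans t∼uvw (SameVertices-sym (proj₂ (triangle-correct w≢u w≢v))))))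
            (MP.∈-map⁺ triangle w∈W)

    triangles⊆new : map triangle W ⊆ new
    triangles⊆new t∈ with MP.∈-map⁻ triangle t∈
    ... | w , w∈W , refl = triangle-new w∈W

    length-new : length new ≡ length W
    length-new = trans (⊆⊇⇒length≡ (UP.filter⁺ New? (triples-unique (endpoints-unique σ′)))
                                    (Unique-map⁺-local triangle (commonNbrs-unique σ u v) triangle-injective)
                                    new⊆triangles triangles⊆new)
                       (LP.length-map triangle W)

  numTriangles-++ : numTriangles σ′ ≡ numTriangles σ ℕ.+ length W
  numTriangles-++ = begin
      numTriangles σ′
    ≡⟨ length-filter-partition (IsTriangle? σ) (IsTriangle? σ′) old⇒new (triples V) ⟩
      length (filter (IsTriangle? σ) (triples V)) ℕ.+ length new
    ≡⟨ cong₂ ℕ._+_ (sym (numTriangles-over σ (endpoints-unique σ′) (endpoints-mono {σ} {σ′} MP.∈-++⁺ˡ))) length-new ⟩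
      numTriangles σ ℕ.+ length W
    ∎
    where
    open ≡-Reasoning
    old⇒new : ∀ {t} → IsTriangle σ t → IsTriangle σ′ t
    old⇒new (increasing , (xy , yz , zx)) = increasing , (Adj-++⁺ {σ} xy , Adj-++⁺ {σ} yz , Adj-++⁺ {σ} zx)

open NewTriangles using (numTriangles-++)

updatedCounter : (M t : ℕ) → Edge → List Edge → ℚ → ℚ
updatedCounter M t (u , v) S τ = τ ℚ.+ η M t ℚ.* fromℕ (length (commonNbrs S u v))

-- step with its case split on t ≤? M taken as an argument: selecting a branch through step′ avoids
-- a with-abstraction over step, which would normalise the rational counter update.
step′ : (M t : ℕ) → Edge → State → Dec (t ≤ M) → Dist State
step′ M t e (S , τ) (yes _) = return (S ++ [ e ] , updatedCounter M t e S τ)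
step′ M t e (S , τ) (no _)  =
  map (λ R → (frac M t ℚ.* frac 1 (length S) , (R ++ [ e ] , updatedCounter M t e S τ))) (removals S)
  ++ [ (1ℚ ℚ.- frac M t , (S , updatedCounter M t e S τ)) ]

step≡step′ : ∀ M t e s → step M t e s ≡ step′ M t e s (t ℕ.≤? M)
step≡step′ M t (u , v) (S , τ) with t ℕ.≤? M
... | yes _ = refl
... | no _  = cong (_++ [ (1ℚ ℚ.- frac M t , (S , τ′)) ])
                   (trans (LP.map-∘ (allFin (length S))) (cong (map evict) (map-removeAt-allFin S)))
  where
  τ′ = updatedCounter M t (u , v) S τ
  evict : List Edge → ℚ × State
  evict R = (frac M t ℚ.* frac 1 (length S) , (R ++ [ (u , v) ] , τ′))

step-≤ : ∀ {M t} e S τ (t≤M : t ≤ M) → step M t e (S , τ) ≡ step′ M t e (S , τ) (yes t≤M)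
step-≤ {M} {t} e S τ t≤M = trans (step≡step′ M t e (S , τ)) (select (t ℕ.≤? M))
  where
  select : (t≤?M : Dec (t ≤ M)) → step′ M t e (S , τ) t≤?M ≡ step′ M t e (S , τ) (yes t≤M)
  select (yes _)   = refl
  select (no t≰M) = ⊥-elim (t≰M t≤M)

step-> : ∀ {M t} e S τ (t≰M : ¬ t ≤ M) → step M t e (S , τ) ≡ step′ M t e (S , τ) (no t≰M)
step-> {M} {t} e S τ t≰M = trans (step≡step′ M t e (S , τ)) (select (t ℕ.≤? M))
  where
  select : (t≤?M : Dec (t ≤ M)) → step′ M t e (S , τ) t≤?M ≡ step′ M t e (S , τ) (no t≰M)
  select (yes t≤M) = ⊥-elim (t≰M t≤M)
  select (no _)    = refl

runFrom-++ : ∀ M t d xs e → runFrom M t d (xs ++ [ e ]) ≡ (runFrom M t d xs >>= step M (suc (t ℕ.+ length xs)) e)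
runFrom-++ M t d []       e = cong (λ t′ → d >>= step M (suc t′) e) (sym (ℕP.+-identityʳ t))
runFrom-++ M t d (x ∷ xs) e = trans (runFrom-++ M (suc t) (d >>= step M (suc t) x) xs e)
  (cong (λ t′ → runFrom M (suc t) (d >>= step M (suc t) x) xs >>= step M (suc t′) e) (sym (ℕP.+-suc t (length xs))))

triestImpr-++ : ∀ M σ e → triestImpr M (σ ++ [ e ]) ≡ (triestImpr M σ >>= step M (suc (length σ)) e)
triestImpr-++ M σ e = runFrom-++ M 0 (return ([] , 0ℚ)) σ e

η-≤ : ∀ {M t} → t ≤ M → η M t ≡ 1ℚ
η-≤ {M} {t} t≤M = ℚP.p≥q⇒p⊔q≡p (frac≤1 (ℕP.*-mono-≤ (ℕP.≤-trans (ℕP.m∸n≤m t 1) t≤M)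
  (ℕP.≤-trans (ℕP.∸-monoˡ-≤ 2 t≤M) (ℕP.∸-monoʳ-≤ M (s≤s z≤n)))))

updatedCounter-exact : ∀ {M t} σ u v → ValidStream (σ ++ [ (u , v) ]) → t ≤ M →
  updatedCounter M t (u , v) σ (fromℕ (numTriangles σ)) ≡ fromℕ (numTriangles (σ ++ [ (u , v) ]))
updatedCounter-exact {M} {t} σ u v valid t≤M = begin
    fromℕ (numTriangles σ) ℚ.+ η M t ℚ.* fromℕ (length W)
  ≡⟨ cong (λ c → fromℕ (numTriangles σ) ℚ.+ c ℚ.* fromℕ (length W)) (η-≤ t≤M) ⟩
    fromℕ (numTriangles σ) ℚ.+ 1ℚ ℚ.* fromℕ (length W)
  ≡⟨ cong (fromℕ (numTriangles σ) ℚ.+_) (ℚP.*-identityˡ _) ⟩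
    fromℕ (numTriangles σ) ℚ.+ fromℕ (length W)
  ≡⟨ fromℕ-+ (numTriangles σ) (length W) ⟩
    fromℕ (numTriangles σ ℕ.+ length W)
  ≡⟨ cong fromℕ (numTriangles-++ σ u v valid) ⟨
    fromℕ (numTriangles (σ ++ [ (u , v) ]))
  ∎
  where
  open ≡-Reasoning
  W = commonNbrs σ u v

triestImpr-≤ : ∀ M σ → ValidStream σ → length σ ≤ M → triestImpr M σ ≡ [ (1ℚ , (σ , fromℕ (numTriangles σ))) ]
triestImpr-≤ M σ = go (reverseView σ)
  where
  go : ∀ {σ} → Reverse σ → ValidStream σ → length σ ≤ M → triestImpr M σ ≡ [ (1ℚ , (σ , fromℕ (numTriangles σ))) ]
  go []                       _     _    = refl
  go (σ ∶ σ-view ∶ʳ (u , v)) valid |σ′|≤M = begin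
      triestImpr M (σ ++ [ (u , v) ])
    ≡⟨ triestImpr-++ M σ (u , v) ⟩
      triestImpr M σ >>= step M t (u , v)
    ≡⟨ cong (_>>= step M t (u , v)) (go σ-view (ValidStream-init σ valid) (ℕP.<⇒≤ t≤M)) ⟩
      [ (1ℚ , (σ , fromℕ (numTriangles σ))) ] >>= step M t (u , v)
    ≡⟨ cong (λ d → map (λ qy → (1ℚ ℚ.* proj₁ qy , proj₂ qy)) d ++ []) (step-≤ (u , v) σ _ t≤M) ⟩
      [ (1ℚ , (σ ++ [ (u , v) ] , updatedCounter M t (u , v) σ (fromℕ (numTriangles σ)))) ]
    ≡⟨ cong (λ c → [ (1ℚ , (σ ++ [ (u , v) ] , c)) ]) (updatedCounter-exact σ u v valid t≤M) ⟩
      [ (1ℚ , (σ ++ [ (u , v) ] , fromℕ (numTriangles (σ ++ [ (u , v) ])))) ]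
    ∎
    where
    open ≡-Reasoning
    t = suc (length σ)
    t≤M : t ≤ M
    t≤M = subst (_≤ M) (length-++-[] σ (u , v)) |σ′|≤M

-- The reservoir phase

module Reservoir (m : ℕ) where

  M : ℕ
  M = suc (suc m)

  FullSample : List Edge → List Edge → Set
  FullSample σ S = Unique S × S ⊆ σ × length S ≡ M

  inSample : Edge → State → ℚ
  inSample a s = fromℕ (𝟙∈ a (sample s))

  bothInSample : Edge → Edge → State → ℚ
  bothInSample a b s = fromℕ (𝟙∈² a b (sample s))

  -- the probabilities that one, resp. two, given edges among the first n lie in a uniform M-subset of them
  inclusion₁ inclusion₂ : ℕ → ℚ
  inclusion₁ n = frac M n
  inclusion₂ n = frac (M ℕ.* (M ∸ 1)) (n ℕ.* (n ∸ 1))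

  record Invariant (σ : List Edge) (n : ℕ) (d : Dist State) : Set where
    field
      full      : All (λ px → FullSample σ (sample (proj₂ px))) d
      mass≡1    : mass d ≡ 1ℚ
      unbiased  : 𝔼 d counter ≡ fromℕ (numTriangles σ)
      𝔼[a∈S]    : ∀ {a} → a ∈ σ → 𝔼 d (inSample a) ≡ inclusion₁ n
      𝔼[a,b∈S]  : ∀ {a b} → a ∈ σ → b ∈ σ → a ≢ b → 𝔼 d (bothInSample a b) ≡ inclusion₂ n

  Invariant-start : ∀ σ → ValidStream σ → length σ ≡ M → Invariant σ M [ (1ℚ , (σ , fromℕ (numTriangles σ))) ]
  Invariant-start σ (_ , simple) |σ|≡M = record
    { full     = (Simple⇒Unique simple , id , |σ|≡M) ∷ []
    ; mass≡1   = refl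
    ; unbiased = trans (ℚP.+-identityʳ _) (ℚP.*-identityˡ _)
    ; 𝔼[a∈S]   = λ a∈σ → trans (cong (λ k → 1ℚ ℚ.* fromℕ k ℚ.+ 0ℚ) (𝟙∈-∈ a∈σ)) (sym (frac-self (ℕ.pred M)))
    ; 𝔼[a,b∈S] = λ a∈σ b∈σ _ → trans (cong₂ (λ k l → 1ℚ ℚ.* fromℕ (k ℕ.* l) ℚ.+ 0ℚ) (𝟙∈-∈ a∈σ) (𝟙∈-∈ b∈σ))
                                     (sym (frac-self (ℕ.pred (M ℕ.* (M ∸ 1)))))
    }

  -- The arrival at time T = n + 1 with n = k + 2 ≥ M; writing n this way makes n ∸ 1 and n ∸ 2 compute.
  module Arrival (k : ℕ) (M≤n : M ≤ suc (suc k)) where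

    n T : ℕ
    n = suc (suc k)
    T = suc n

    i : ℚ
    i = frac 1 T

    T≰M : ¬ T ≤ M
    T≰M T≤M = ℕP.<-irrefl refl (ℕP.≤-trans T≤M M≤n)

    M/T≡M*i : frac M T ≡ fromℕ M ℚ.* i
    M/T≡M*i = sym (trans (frac-* M 0 1 n) (frac-cong (M ℕ.* 1) (ℕ.pred (1 ℕ.* T)) M n (rearrange m n)))
      where
      rearrange : ∀ m n → (suc (suc m) ℕ.* 1) ℕ.* suc n ≡ suc (suc m) ℕ.* (1 ℕ.* suc n)
      rearrange = solve-∀

    1-c*i : ∀ c → c ≤ T → 1ℚ ℚ.- fromℕ c ℚ.* i ≡ frac (T ∸ c) T
    1-c*i c c≤T = trans (cong (λ x → 1ℚ ℚ.- x) c*i≡c/T) (1-frac c n c≤T)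
      where
      c*i≡c/T : fromℕ c ℚ.* i ≡ frac c T
      c*i≡c/T = trans (frac-* c 0 1 n) (frac-cong (c ℕ.* 1) (ℕ.pred (1 ℕ.* T)) c n (rearrange c n))
        where
        rearrange : ∀ c n → (c ℕ.* 1) ℕ.* suc n ≡ c ℕ.* (1 ℕ.* suc n)
        rearrange = solve-∀

    inclusion₁-survive : (1ℚ ℚ.- fromℕ 1 ℚ.* i) ℚ.* inclusion₁ n ≡ inclusion₁ T
    inclusion₁-survive = begin
        (1ℚ ℚ.- fromℕ 1 ℚ.* i) ℚ.* frac M n  ≡⟨ cong (ℚ._* frac M n) (1-c*i 1 (s≤s z≤n)) ⟩
        frac n T ℚ.* frac M n                ≡⟨ frac-* n n M (suc k) ⟩
        frac (n ℕ.* M) (T ℕ.* n)             ≡⟨ frac-cong (n ℕ.* M) (suc k ℕ.+ n ℕ.* suc (suc k)) M n (cancel k m) ⟩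
        frac M T                             ∎
      where
      open ≡-Reasoning
      cancel : ∀ k m → (suc (suc k) ℕ.* suc (suc m)) ℕ.* suc (suc (suc k))
                     ≡ suc (suc m) ℕ.* (suc (suc (suc k)) ℕ.* suc (suc k))
      cancel = solve-∀

    inclusion₂-survive : (1ℚ ℚ.- fromℕ 2 ℚ.* i) ℚ.* inclusion₂ n ≡ inclusion₂ T
    inclusion₂-survive = begin
        (1ℚ ℚ.- fromℕ 2 ℚ.* i) ℚ.* frac (M ℕ.* suc m) (n ℕ.* suc k)
      ≡⟨ cong (ℚ._* frac (M ℕ.* suc m) (n ℕ.* suc k)) (1-c*i 2 (s≤s (s≤s z≤n))) ⟩
        frac (suc k) T ℚ.* frac (M ℕ.* suc m) (n ℕ.* suc k)
      ≡⟨ frac-* (suc k) n (M ℕ.* suc m) (k ℕ.+ suc k ℕ.* suc k) ⟩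
        frac (suc k ℕ.* (M ℕ.* suc m)) (T ℕ.* (n ℕ.* suc k))
      ≡⟨ frac-cong (suc k ℕ.* (M ℕ.* suc m)) (ℕ.pred (T ℕ.* (n ℕ.* suc k)))
                   (M ℕ.* suc m) (suc k ℕ.+ n ℕ.* suc (suc k)) (cancel m k) ⟩
        frac (M ℕ.* suc m) (T ℕ.* n)
      ∎
      where
      open ≡-Reasoning
      cancel : ∀ m k → (suc k ℕ.* (suc (suc m) ℕ.* suc m)) ℕ.* (suc (suc (suc k)) ℕ.* suc (suc k))
                     ≡ (suc (suc m) ℕ.* suc m) ℕ.* (suc (suc (suc k)) ℕ.* (suc (suc k) ℕ.* suc k))
      cancel = solve-∀

    inclusion₁-enter : fromℕ M ℚ.* i ≡ inclusion₁ T
    inclusion₁-enter = sym M/T≡M*i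

    inclusion₂-enter : (fromℕ M ℚ.* i ℚ.- i) ℚ.* inclusion₁ n ≡ inclusion₂ T
    inclusion₂-enter = begin
        (fromℕ M ℚ.* i ℚ.- i) ℚ.* frac M n     ≡⟨ cong (ℚ._* frac M n) M*i-i≡[M-1]/T ⟩
        frac (suc m) T ℚ.* frac M n            ≡⟨ frac-* (suc m) n M (suc k) ⟩
        frac (suc m ℕ.* M) (T ℕ.* n)           ≡⟨ cong (λ a → frac a (T ℕ.* n)) (ℕP.*-comm (suc m) M) ⟩
        frac (M ℕ.* suc m) (T ℕ.* n)           ∎
      where
      open ≡-Reasoning
      M*i-i≡[M-1]/T : fromℕ M ℚ.* i ℚ.- i ≡ frac (suc m) T
      M*i-i≡[M-1]/T = trans (cong (ℚ._- i) (sym M/T≡M*i)) (sym (x+y≡z⇒x≡z-y (frac (suc m) T) i (frac M T)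
        (trans (frac-+ (suc m) n 1 n) (frac-cong (suc m ℕ.* T ℕ.+ 1 ℕ.* T) (n ℕ.+ n ℕ.* T) M n (rearrange m n)))))
        where
        rearrange : ∀ m n → (suc m ℕ.* suc n ℕ.+ 1 ℕ.* suc n) ℕ.* suc n ≡ suc (suc m) ℕ.* (suc n ℕ.* suc n)
        rearrange = solve-∀

    -- η^(T) is the reciprocal of the probability that both other edges of a wedge are sampled.
    η*inclusion₂≡1 : η M T ℚ.* inclusion₂ n ≡ 1ℚ
    η*inclusion₂≡1 = begin
        η M T ℚ.* inclusion₂ n
      ≡⟨ cong (ℚ._* inclusion₂ n) (ℚP.p≤q⇒p⊔q≡q 1≤η) ⟩
        frac N D ℚ.* frac D N
      ≡⟨ frac-* N (ℕ.pred D) D (ℕ.pred N) ⟩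
        frac (N ℕ.* D) (D ℕ.* N)
      ≡⟨ frac-cong (N ℕ.* D) (ℕ.pred (D ℕ.* N)) 1 0
                   (trans (ℕP.*-identityʳ _) (trans (ℕP.*-comm N D) (sym (ℕP.*-identityˡ _)))) ⟩
        1ℚ
      ∎
      where
      open ≡-Reasoning
      N D : ℕ
      N = n ℕ.* suc k
      D = M ℕ.* suc m
      1≤η : 1ℚ ℚ.≤ frac N D
      1≤η = frac-≤ 1 0 N (ℕ.pred D) (subst₂ _≤_ (sym (ℕP.*-identityˡ D)) (sym (ℕP.*-identityʳ N))
                                          (ℕP.*-mono-≤ M≤n (ℕP.≤-pred M≤n)))

    module FromState (e : Edge) (S : List Edge) (τ : ℚ) (|S|≡M : length S ≡ M) where

      τ′ : ℚ
      τ′ = updatedCounter M T e S τ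

      eviction-probability : frac M T ℚ.* frac 1 (length S) ≡ i
      eviction-probability = trans (cong (λ l → frac M T ℚ.* frac 1 l) |S|≡M)
                                   (trans (frac-* M n 1 (suc m)) (frac-cong (M ℕ.* 1) (ℕ.pred (T ℕ.* M)) 1 n (rearrange m n)))
        where
        rearrange : ∀ m n → (suc (suc m) ℕ.* 1) ℕ.* suc n ≡ 1 ℕ.* (suc n ℕ.* suc (suc m))
        rearrange = solve-∀

      𝔼-arrival : (g : State → ℚ) → 𝔼 (step M T e (S , τ)) g ≡
        i ℚ.* sumℚ (map (λ R → g (R ++ [ e ] , τ′)) (removals S)) ℚ.+ ((1ℚ ℚ.- fromℕ M ℚ.* i) ℚ.* g (S , τ′) ℚ.+ 0ℚ)
      𝔼-arrival g = begin
          𝔼 (step M T e (S , τ)) g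
        ≡⟨ cong (λ d → 𝔼 d g) (step-> e S τ T≰M) ⟩
          𝔼 (map (λ R → (w , (R ++ [ e ] , τ′))) (removals S) ++ [ (1ℚ ℚ.- frac M T , (S , τ′)) ]) g
        ≡⟨ 𝔼-++ (map (λ R → (w , (R ++ [ e ] , τ′))) (removals S)) _ g ⟩
          𝔼 (map (λ R → (w , (R ++ [ e ] , τ′))) (removals S)) g ℚ.+ ((1ℚ ℚ.- frac M T) ℚ.* g (S , τ′) ℚ.+ 0ℚ)
        ≡⟨ cong₂ (λ p q → p ℚ.+ ((1ℚ ℚ.- q) ℚ.* g (S , τ′) ℚ.+ 0ℚ))
                 (trans (𝔼-uniform w (λ R → (R ++ [ e ] , τ′)) (removals S) g) (cong (ℚ._* Σg) eviction-probability))
                 M/T≡M*i ⟩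
          i ℚ.* sumℚ (map (λ R → g (R ++ [ e ] , τ′)) (removals S)) ℚ.+ ((1ℚ ℚ.- fromℕ M ℚ.* i) ℚ.* g (S , τ′) ℚ.+ 0ℚ)
        ∎
        where
        open ≡-Reasoning
        w = frac M T ℚ.* frac 1 (length S)
        Σg = sumℚ (map (λ R → g (R ++ [ e ] , τ′)) (removals S))

      |removals|≡M : length (removals S) ≡ M
      |removals|≡M = trans (length-removals S) |S|≡M

      𝔼-arrival-const : (g : State → ℚ) (κ : ℚ) → (∀ R → g (R ++ [ e ] , τ′) ≡ κ) → g (S , τ′) ≡ κ →
        𝔼 (step M T e (S , τ)) g ≡ κ
      𝔼-arrival-const g κ g≡κ g′≡κ = begin
          𝔼 (step M T e (S , τ)) g
        ≡⟨ 𝔼-arrival g ⟩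
          i ℚ.* sumℚ (map (λ R → g (R ++ [ e ] , τ′)) (removals S)) ℚ.+ ((1ℚ ℚ.- fromℕ M ℚ.* i) ℚ.* g (S , τ′) ℚ.+ 0ℚ)
        ≡⟨ cong₂ (λ p q → i ℚ.* p ℚ.+ ((1ℚ ℚ.- fromℕ M ℚ.* i) ℚ.* q ℚ.+ 0ℚ))
                 (trans (sumℚ-const _ κ (removals S) (λ {R} _ → g≡κ R)) (cong (λ l → fromℕ l ℚ.* κ) |removals|≡M))
                 g′≡κ ⟩
          i ℚ.* (fromℕ M ℚ.* κ) ℚ.+ ((1ℚ ℚ.- fromℕ M ℚ.* i) ℚ.* κ ℚ.+ 0ℚ)
        ≡⟨ solve 3 (λ i m k → i :* (m :* k) :+ ((con 1ℚ :- m :* i) :* k :+ con 0ℚ) := k) refl i (fromℕ M) κ ⟩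
          κ
        ∎
        where open ≡-Reasoning

      𝔼-arrival-sample : (h : List Edge → ℕ) → 𝔼 (step M T e (S , τ)) (λ s → fromℕ (h (sample s))) ≡
        i ℚ.* fromℕ (sum (map (λ R → h (R ++ [ e ])) (removals S))) ℚ.+ (1ℚ ℚ.- fromℕ M ℚ.* i) ℚ.* fromℕ (h S)
      𝔼-arrival-sample h = trans (𝔼-arrival _)
        (cong₂ (λ p q → i ℚ.* p ℚ.+ q) (sumℚ-fromℕ (λ R → h (R ++ [ e ])) (removals S)) (ℚP.+-identityʳ _))

      𝔼-arrival-old : (h : List Edge → ℕ) (c : ℕ) → (∀ R → h (R ++ [ e ]) ≡ h R) →
        sum (map h (removals S)) ℕ.+ c ℕ.* h S ≡ h S ℕ.* M →
        𝔼 (step M T e (S , τ)) (λ s → fromℕ (h (sample s))) ≡ fromℕ (h S) ℚ.* (1ℚ ℚ.- fromℕ c ℚ.* i)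
      𝔼-arrival-old h c h-old survivors = begin
          𝔼 (step M T e (S , τ)) (λ s → fromℕ (h (sample s)))
        ≡⟨ 𝔼-arrival-sample h ⟩
          i ℚ.* fromℕ (sum (map (λ R → h (R ++ [ e ])) (removals S))) ℚ.+ (1ℚ ℚ.- fromℕ M ℚ.* i) ℚ.* fromℕ (h S)
        ≡⟨ cong (λ x → i ℚ.* fromℕ x ℚ.+ _) (cong sum (LP.map-cong h-old (removals S))) ⟩
          i ℚ.* fromℕ X ℚ.+ (1ℚ ℚ.- fromℕ M ℚ.* i) ℚ.* fromℕ (h S)
        ≡⟨ cong (λ x → i ℚ.* x ℚ.+ _) (fromℕ-x+ck≡km X (h S) c M survivors) ⟩
          i ℚ.* (fromℕ (h S) ℚ.* fromℕ M ℚ.- fromℕ c ℚ.* fromℕ (h S)) ℚ.+ (1ℚ ℚ.- fromℕ M ℚ.* i) ℚ.* fromℕ (h S)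
        ≡⟨ solve 4 (λ i m c k → i :* (k :* m :- c :* k) :+ (con 1ℚ :- m :* i) :* k := k :* (con 1ℚ :- c :* i))
                 refl i (fromℕ M) (fromℕ c) (fromℕ (h S)) ⟩
          fromℕ (h S) ℚ.* (1ℚ ℚ.- fromℕ c ℚ.* i)
        ∎
        where
        open ≡-Reasoning
        X = sum (map h (removals S))

      𝔼-arrival-new : (h h′ : List Edge → ℕ) → (∀ R → h (R ++ [ e ]) ≡ h′ R) → h S ≡ 0 →
        𝔼 (step M T e (S , τ)) (λ s → fromℕ (h (sample s))) ≡ i ℚ.* fromℕ (sum (map h′ (removals S)))
      𝔼-arrival-new h h′ h-new hS≡0 = begin
          𝔼 (step M T e (S , τ)) (λ s → fromℕ (h (sample s)))
        ≡⟨ 𝔼-arrival-sample h ⟩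
          i ℚ.* fromℕ (sum (map (λ R → h (R ++ [ e ])) (removals S))) ℚ.+ (1ℚ ℚ.- fromℕ M ℚ.* i) ℚ.* fromℕ (h S)
        ≡⟨ cong₂ (λ x y → i ℚ.* fromℕ x ℚ.+ (1ℚ ℚ.- fromℕ M ℚ.* i) ℚ.* fromℕ y)
                 (cong sum (LP.map-cong h-new (removals S))) hS≡0 ⟩
          i ℚ.* fromℕ (sum (map h′ (removals S))) ℚ.+ (1ℚ ℚ.- fromℕ M ℚ.* i) ℚ.* 0ℚ
        ≡⟨ trans (cong (i ℚ.* fromℕ (sum (map h′ (removals S))) ℚ.+_) (ℚP.*-zeroʳ (1ℚ ℚ.- fromℕ M ℚ.* i)))
                 (ℚP.+-identityʳ _) ⟩
          i ℚ.* fromℕ (sum (map h′ (removals S)))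
        ∎
        where open ≡-Reasoning

      arrival-inSample-old : ∀ {a} → a ≢ e → Unique S →
        𝔼 (step M T e (S , τ)) (inSample a) ≡ inSample a (S , τ) ℚ.* (1ℚ ℚ.- fromℕ 1 ℚ.* i)
      arrival-inSample-old {a} a≢e !S = 𝔼-arrival-old (𝟙∈ a) 1 (λ R → 𝟙∈-++-≢ R a≢e)
        (trans (cong (sum (map (𝟙∈ a) (removals S)) ℕ.+_) (ℕP.*-identityˡ (𝟙∈ a S)))
               (trans (sum-𝟙∈-removals a !S) (cong (𝟙∈ a S ℕ.*_) |S|≡M)))

      arrival-inSample-new : e ∉ S → 𝔼 (step M T e (S , τ)) (inSample e) ≡ fromℕ M ℚ.* i
      arrival-inSample-new e∉S = begin
          𝔼 (step M T e (S , τ)) (inSample e)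
        ≡⟨ 𝔼-arrival-new (𝟙∈ e) (λ _ → 1) (𝟙∈-last e) (𝟙∈-∉ e∉S) ⟩
          i ℚ.* fromℕ (sum (map (λ _ → 1) (removals S)))
        ≡⟨ cong (λ x → i ℚ.* fromℕ x) (trans (sum-map-1≡length _ (removals S) (λ _ → refl)) |removals|≡M) ⟩
          i ℚ.* fromℕ M
        ≡⟨ ℚP.*-comm i (fromℕ M) ⟩
          fromℕ M ℚ.* i
        ∎
        where open ≡-Reasoning

      arrival-bothInSample-old : ∀ {a b} → a ≢ b → a ≢ e → b ≢ e → Unique S →
        𝔼 (step M T e (S , τ)) (bothInSample a b) ≡ bothInSample a b (S , τ) ℚ.* (1ℚ ℚ.- fromℕ 2 ℚ.* i)
      arrival-bothInSample-old {a} {b} a≢b a≢e b≢e !S =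
        𝔼-arrival-old (𝟙∈² a b) 2 (λ R → cong₂ ℕ._*_ (𝟙∈-++-≢ R a≢e) (𝟙∈-++-≢ R b≢e))
          (trans (sum-𝟙∈²-removals a≢b !S) (cong (𝟙∈² a b S ℕ.*_) |S|≡M))

      arrival-bothInSample-new : ∀ {a} → a ≢ e → e ∉ S → Unique S →
        𝔼 (step M T e (S , τ)) (bothInSample a e) ≡ inSample a (S , τ) ℚ.* (fromℕ M ℚ.* i ℚ.- i)
      arrival-bothInSample-new {a} a≢e e∉S !S = begin
          𝔼 (step M T e (S , τ)) (bothInSample a e)
        ≡⟨ 𝔼-arrival-new (𝟙∈² a e) (𝟙∈ a)
                         (λ R → trans (cong₂ ℕ._*_ (𝟙∈-++-≢ R a≢e) (𝟙∈-last e R)) (ℕP.*-identityʳ _))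
                        (trans (cong (𝟙∈ a S ℕ.*_) (𝟙∈-∉ e∉S)) (ℕP.*-zeroʳ (𝟙∈ a S))) ⟩
          i ℚ.* fromℕ X
        ≡⟨ cong (i ℚ.*_) (fromℕ-x+ck≡km X K 1 M survivors) ⟩
          i ℚ.* (fromℕ K ℚ.* fromℕ M ℚ.- 1ℚ ℚ.* fromℕ K)
        ≡⟨ solve 3 (λ i m k → i :* (k :* m :- con 1ℚ :* k) := k :* (m :* i :- i)) refl i (fromℕ M) (fromℕ K) ⟩
          fromℕ K ℚ.* (fromℕ M ℚ.* i ℚ.- i)
        ∎
        where
        open ≡-Reasoning
        K = 𝟙∈ a S
        X = sum (map (𝟙∈ a) (removals S))
        survivors : X ℕ.+ 1 ℕ.* K ≡ K ℕ.* M
        survivors = trans (cong (X ℕ.+_) (ℕP.*-identityˡ K)) (trans (sum-𝟙∈-removals a !S) (cong (K ℕ.*_) |S|≡M))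

    module FromInvariant (σ : List Edge) (u v : ℕ) (valid : ValidStream (σ ++ [ (u , v) ]))
                         (d : Dist State) (inv : Invariant σ n d) where

      open Invariant inv

      e : Edge
      e = (u , v)

      σ′ : List Edge
      σ′ = σ ++ [ e ]

      d′ : Dist State
      d′ = d >>= step M T e

      simple : Simple σ
      simple = AllPairs-init σ (proj₂ valid)

      u≢v : u ≢ v
      u≢v = All.lookup (proj₁ valid) (MP.∈-++⁺ʳ σ (here refl))

      e∉σ : e ∉ σ
      e∉σ e∈σ = AllPairs-last σ (proj₂ valid) e∈σ ≈ₑ-refl

      ∈σ⇒≢e : ∀ {a} → a ∈ σ → a ≢ e
      ∈σ⇒≢e a∈σ refl = e∉σ a∈σ

      𝔼-lift : (g h : State → ℚ) → (∀ S τ → FullSample σ S → 𝔼 (step M T e (S , τ)) g ≡ h (S , τ)) →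
        𝔼 d′ g ≡ 𝔼 d h
      𝔼-lift g h from-full = trans (𝔼->>= d (step M T e) g)
        (𝔼-cong d (All.map (λ {px} → from-full (sample (proj₂ px)) (counter (proj₂ px))) full))

      full′ : All (λ px → FullSample σ′ (sample (proj₂ px))) d′
      full′ = All->>= d (step M T e) (All.map (λ {px} → arrival-full (sample (proj₂ px)) (counter (proj₂ px))) full)
        where
        arrival-full : ∀ S τ → FullSample σ S → All (λ qy → FullSample σ′ (sample (proj₂ qy))) (step M T e (S , τ))
        arrival-full S τ (!S , S⊆σ , |S|≡M) =
          subst (All (λ qy → FullSample σ′ (sample (proj₂ qy)))) (sym (step-> e S τ T≰M))
          (AllP.++⁺ (AllP.map⁺ (All.zipWith evicted (All.zipWith id (removals-unique !S , removals-⊆ S) , removals-length S)))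
                    ((!S , MP.∈-++⁺ˡ ∘ S⊆σ , |S|≡M) ∷ []))
          where
          evicted : ∀ {R} → (Unique R × R ⊆ S) × suc (length R) ≡ length S → FullSample σ′ (R ++ [ e ])
          evicted {R} ((!R , R⊆S) , |R|+1≡|S|) =
            UP.++⁺ !R ([] ∷ []) (λ { (e∈R , here refl) → e∉σ (S⊆σ (R⊆S e∈R)) }) ,
            (λ f∈ → Sum.[ MP.∈-++⁺ˡ ∘ S⊆σ ∘ R⊆S , (λ { (here refl) → MP.∈-++⁺ʳ σ (here refl) }) ] (MP.∈-++⁻ R f∈)) ,
            trans (length-++-[] R e) (trans |R|+1≡|S| |S|≡M)

      mass′ : mass d′ ≡ 1ℚ
      mass′ = trans (𝔼-lift _ (λ _ → 1ℚ) λ S τ (_ , _ , |S|≡M) →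
                       FromState.𝔼-arrival-const e S τ |S|≡M (λ _ → 1ℚ) 1ℚ (λ _ → refl) refl)
                    mass≡1

      W : List ℕ
      W = commonNbrs σ u v

      -- |N^S_{u,v}| counts the wedges u – w – v, w ∈ N_{u,v}, whose two edges are both in S.
      𝔼-commonNbrs : 𝔼 d (λ s → fromℕ (length (commonNbrs (sample s) u v))) ≡ fromℕ (length W) ℚ.* inclusion₂ n
      𝔼-commonNbrs = begin
          𝔼 d (λ s → fromℕ (length (commonNbrs (sample s) u v)))
        ≡⟨ 𝔼-cong d (All.map (λ {px} (_ , S⊆σ , _) → as-wedges (sample (proj₂ px)) S⊆σ) full) ⟩
          𝔼 d (λ s → sumℚ (map (λ w → wedge w s) W))
        ≡⟨ 𝔼-sumℚ d W wedge ⟩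
          sumℚ (map (λ w → 𝔼 d (wedge w)) W)
        ≡⟨ sumℚ-const _ (inclusion₂ n) W 𝔼-wedge ⟩
          fromℕ (length W) ℚ.* inclusion₂ n
        ∎
        where
        open ≡-Reasoning
        wedge : ℕ → State → ℚ
        wedge w s = fromℕ (𝟙 (Adj? (sample s) u w) ℕ.* 𝟙 (Adj? (sample s) v w))
        as-wedges : ∀ S → S ⊆ σ → fromℕ (length (commonNbrs S u v)) ≡ sumℚ (map (λ w → wedge w (S , 0ℚ)) W)
        as-wedges S S⊆σ = trans (cong fromℕ (length-commonNbrs-⊆ σ S u v S⊆σ))
                                (sym (sumℚ-fromℕ (λ w → 𝟙 (Adj? S u w) ℕ.* 𝟙 (Adj? S v w)) W))
        𝔼-wedge : ∀ {w} → w ∈ W → 𝔼 d (wedge w) ≡ inclusion₂ n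
        𝔼-wedge {w} w∈W =
          let uw , vw = ∈-commonNbrs⁻ σ u v w∈W
              a , a∈σ , a≈uw = find uw
              b , b∈σ , b≈vw = find vw
              wedge≡both : ∀ {S} → S ⊆ σ → wedge w (S , 0ℚ) ≡ bothInSample a b (S , 0ℚ)
              wedge≡both S⊆σ =
                cong fromℕ (cong₂ ℕ._*_ (𝟙Adj≡𝟙∈ simple S⊆σ a∈σ a≈uw) (𝟙Adj≡𝟙∈ simple S⊆σ b∈σ b≈vw))
          in trans (𝔼-cong d (All.map (λ {px} (_ , S⊆σ , _) → wedge≡both S⊆σ) full))
                   (𝔼[a,b∈S] a∈σ b∈σ λ a≡b →
                      u≢v (≈ₑ-cancelʳ (≈ₑ-trans (≈ₑ-sym a≈uw) (subst (_≈ₑ (v , w)) (sym a≡b) b≈vw))))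

      unbiased′ : 𝔼 d′ counter ≡ fromℕ (numTriangles σ′)
      unbiased′ = begin
          𝔼 d′ counter
        ≡⟨ 𝔼-lift counter (λ s → counter s ℚ.+ η M T ℚ.* Nₛ s)
                  (λ S τ (_ , _ , |S|≡M) → FromState.𝔼-arrival-const e S τ |S|≡M counter _ (λ _ → refl) refl) ⟩
          𝔼 d (λ s → counter s ℚ.+ η M T ℚ.* Nₛ s)
        ≡⟨ 𝔼-+ d counter (λ s → η M T ℚ.* Nₛ s) ⟩
          𝔼 d counter ℚ.+ 𝔼 d (λ s → η M T ℚ.* Nₛ s)
        ≡⟨ cong₂ ℚ._+_ unbiased (𝔼-*ˡ (η M T) d Nₛ) ⟩
          fromℕ (numTriangles σ) ℚ.+ η M T ℚ.* 𝔼 d Nₛ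
        ≡⟨ cong (λ x → fromℕ (numTriangles σ) ℚ.+ η M T ℚ.* x) 𝔼-commonNbrs ⟩
          fromℕ (numTriangles σ) ℚ.+ η M T ℚ.* (fromℕ (length W) ℚ.* inclusion₂ n)
        ≡⟨ cong (fromℕ (numTriangles σ) ℚ.+_) η-cancels ⟩
          fromℕ (numTriangles σ) ℚ.+ fromℕ (length W)
        ≡⟨ fromℕ-+ (numTriangles σ) (length W) ⟩
          fromℕ (numTriangles σ ℕ.+ length W)
        ≡⟨ cong fromℕ (numTriangles-++ σ u v valid) ⟨
          fromℕ (numTriangles σ′)
        ∎
        where
        open ≡-Reasoning
        Nₛ : State → ℚ
        Nₛ s = fromℕ (length (commonNbrs (sample s) u v))
        η-cancels : η M T ℚ.* (fromℕ (length W) ℚ.* inclusion₂ n) ≡ fromℕ (length W)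
        η-cancels = begin
            η M T ℚ.* (fromℕ (length W) ℚ.* inclusion₂ n)
              ≡⟨ solve 3 (λ a w b → a :* (w :* b) := w :* (a :* b)) refl (η M T) (fromℕ (length W)) (inclusion₂ n) ⟩
            fromℕ (length W) ℚ.* (η M T ℚ.* inclusion₂ n)  ≡⟨ cong (fromℕ (length W) ℚ.*_) η*inclusion₂≡1 ⟩
            fromℕ (length W) ℚ.* 1ℚ                        ≡⟨ ℚP.*-identityʳ _ ⟩
            fromℕ (length W)                               ∎

      𝔼[a∈S]-old : ∀ {a} → a ∈ σ → 𝔼 d′ (inSample a) ≡ inclusion₁ T
      𝔼[a∈S]-old {a} a∈σ = begin
          𝔼 d′ (inSample a)
        ≡⟨ 𝔼-lift _ (λ s → inSample a s ℚ.* (1ℚ ℚ.- fromℕ 1 ℚ.* i))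
                  (λ S τ (!S , _ , |S|≡M) → FromState.arrival-inSample-old e S τ |S|≡M (∈σ⇒≢e a∈σ) !S) ⟩
          𝔼 d (λ s → inSample a s ℚ.* (1ℚ ℚ.- fromℕ 1 ℚ.* i))
        ≡⟨ 𝔼-*ʳ _ d (inSample a) ⟩
          (1ℚ ℚ.- fromℕ 1 ℚ.* i) ℚ.* 𝔼 d (inSample a)
        ≡⟨ cong ((1ℚ ℚ.- fromℕ 1 ℚ.* i) ℚ.*_) (𝔼[a∈S] a∈σ) ⟩
          (1ℚ ℚ.- fromℕ 1 ℚ.* i) ℚ.* inclusion₁ n
        ≡⟨ inclusion₁-survive ⟩
          inclusion₁ T
        ∎
        where open ≡-Reasoning

      𝔼[e∈S] : 𝔼 d′ (inSample e) ≡ inclusion₁ T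
      𝔼[e∈S] = begin
          𝔼 d′ (inSample e)
        ≡⟨ 𝔼-lift _ (λ _ → fromℕ M ℚ.* i)
                  (λ S τ (_ , S⊆σ , |S|≡M) → FromState.arrival-inSample-new e S τ |S|≡M (e∉σ ∘ S⊆σ)) ⟩
          𝔼 d (λ _ → fromℕ M ℚ.* i)
        ≡⟨ 𝔼-const _ d ⟩
          fromℕ M ℚ.* i ℚ.* mass d
        ≡⟨ cong (fromℕ M ℚ.* i ℚ.*_) mass≡1 ⟩
          fromℕ M ℚ.* i ℚ.* 1ℚ
        ≡⟨ ℚP.*-identityʳ _ ⟩
          fromℕ M ℚ.* i
        ≡⟨ inclusion₁-enter ⟩
          inclusion₁ T
        ∎
        where open ≡-Reasoning

      𝔼[a,b∈S]-old : ∀ {a b} → a ∈ σ → b ∈ σ → a ≢ b → 𝔼 d′ (bothInSample a b) ≡ inclusion₂ T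
      𝔼[a,b∈S]-old {a} {b} a∈σ b∈σ a≢b = begin
          𝔼 d′ (bothInSample a b)
        ≡⟨ 𝔼-lift _ (λ s → bothInSample a b s ℚ.* (1ℚ ℚ.- fromℕ 2 ℚ.* i))
                  (λ S τ (!S , _ , |S|≡M) →
                     FromState.arrival-bothInSample-old e S τ |S|≡M a≢b (∈σ⇒≢e a∈σ) (∈σ⇒≢e b∈σ) !S) ⟩
          𝔼 d (λ s → bothInSample a b s ℚ.* (1ℚ ℚ.- fromℕ 2 ℚ.* i))
        ≡⟨ 𝔼-*ʳ _ d (bothInSample a b) ⟩
          (1ℚ ℚ.- fromℕ 2 ℚ.* i) ℚ.* 𝔼 d (bothInSample a b)
        ≡⟨ cong ((1ℚ ℚ.- fromℕ 2 ℚ.* i) ℚ.*_) (𝔼[a,b∈S] a∈σ b∈σ a≢b) ⟩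
          (1ℚ ℚ.- fromℕ 2 ℚ.* i) ℚ.* inclusion₂ n
        ≡⟨ inclusion₂-survive ⟩
          inclusion₂ T
        ∎
        where open ≡-Reasoning

      𝔼[a,e∈S] : ∀ {a} → a ∈ σ → 𝔼 d′ (bothInSample a e) ≡ inclusion₂ T
      𝔼[a,e∈S] {a} a∈σ = begin
          𝔼 d′ (bothInSample a e)
        ≡⟨ 𝔼-lift _ (λ s → inSample a s ℚ.* (fromℕ M ℚ.* i ℚ.- i))
                  (λ S τ (!S , S⊆σ , |S|≡M) →
                     FromState.arrival-bothInSample-new e S τ |S|≡M (∈σ⇒≢e a∈σ) (e∉σ ∘ S⊆σ) !S) ⟩
          𝔼 d (λ s → inSample a s ℚ.* (fromℕ M ℚ.* i ℚ.- i))
        ≡⟨ 𝔼-*ʳ _ d (inSample a) ⟩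
          (fromℕ M ℚ.* i ℚ.- i) ℚ.* 𝔼 d (inSample a)
        ≡⟨ cong ((fromℕ M ℚ.* i ℚ.- i) ℚ.*_) (𝔼[a∈S] a∈σ) ⟩
          (fromℕ M ℚ.* i ℚ.- i) ℚ.* inclusion₁ n
        ≡⟨ inclusion₂-enter ⟩
          inclusion₂ T
        ∎
        where open ≡-Reasoning

      𝔼[a,b∈S]′ : ∀ {a b} → a ∈ σ′ → b ∈ σ′ → a ≢ b → 𝔼 d′ (bothInSample a b) ≡ inclusion₂ T
      𝔼[a,b∈S]′ {a} {b} a∈σ′ b∈σ′ a≢b = by-cases (MP.∈-++⁻ σ a∈σ′) (MP.∈-++⁻ σ b∈σ′)
        where
        by-cases : a ∈ σ ⊎ a ∈ [ e ] → b ∈ σ ⊎ b ∈ [ e ] → 𝔼 d′ (bothInSample a b) ≡ inclusion₂ T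
        by-cases (inj₁ a∈σ)        (inj₁ b∈σ)        = 𝔼[a,b∈S]-old a∈σ b∈σ a≢b
        by-cases (inj₁ a∈σ)        (inj₂ (here refl)) = 𝔼[a,e∈S] a∈σ
        by-cases (inj₂ (here refl)) (inj₁ b∈σ)        =
          trans (𝔼-cong d′ (All.universal (λ px → cong fromℕ (𝟙∈²-comm e b (sample (proj₂ px)))) d′))
                (𝔼[a,e∈S] b∈σ)
        by-cases (inj₂ (here refl)) (inj₂ (here refl)) = ⊥-elim (a≢b refl)

      invariant′ : Invariant σ′ T d′
      invariant′ = record
        { full     = full′
        ; mass≡1   = mass′
        ; unbiased = unbiased′
        ; 𝔼[a∈S]   = λ a∈σ′ → Sum.[ 𝔼[a∈S]-old , (λ { (here refl) → 𝔼[e∈S] }) ] (MP.∈-++⁻ σ a∈σ′)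
        ; 𝔼[a,b∈S] = 𝔼[a,b∈S]′
        }

  Invariant-arrival : ∀ σ u v → ValidStream (σ ++ [ (u , v) ]) → M ≤ length σ → ∀ {d} → Invariant σ (length σ) d →
    Invariant (σ ++ [ (u , v) ]) (suc (length σ)) (d >>= step M (suc (length σ)) (u , v))
  Invariant-arrival σ u v valid M≤|σ| {d} inv =
    let o , M+o≡|σ| = ℕP.m≤n⇒∃[o]m+o≡n M≤|σ|
    in subst (λ n → Invariant (σ ++ [ (u , v) ]) (suc n) (d >>= step M (suc n) (u , v))) M+o≡|σ|
         (Arrival.FromInvariant.invariant′ (m ℕ.+ o) (ℕP.m≤m+n M o) σ u v valid d
           (subst (λ n → Invariant σ n d) (sym M+o≡|σ|) inv))

  Invariant-triestImpr : ∀ σ → ValidStream σ → M ≤ length σ → Invariant σ (length σ) (triestImpr M σ)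
  Invariant-triestImpr σ = go (reverseView σ)
    where
    go : ∀ {σ} → Reverse σ → ValidStream σ → M ≤ length σ → Invariant σ (length σ) (triestImpr M σ)
    go []                   _     ()
    go (σ ∶ view ∶ʳ (u , v)) valid M≤|σ′| = by-cases (M ℕ.≤? length σ)
      where
      σ′ = σ ++ [ (u , v) ]
      |σ′|≡1+|σ| = length-++-[] σ (u , v)
      by-cases : Dec (M ≤ length σ) → Invariant σ′ (length σ′) (triestImpr M σ′)
      by-cases (yes M≤|σ|) = subst₂ (Invariant σ′) (sym |σ′|≡1+|σ|) (sym (triestImpr-++ M σ (u , v)))
        (Invariant-arrival σ u v valid M≤|σ| (go view (ValidStream-init σ valid) M≤|σ|))
      by-cases (no M≰|σ|) =
        subst₂ (Invariant σ′) (sym |σ′|≡M) (sym (triestImpr-≤ M σ′ valid (ℕP.≤-reflexive |σ′|≡M)))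
               (Invariant-start σ′ valid |σ′|≡M)
        where
        |σ′|≡M : length σ′ ≡ M
        |σ′|≡M = ℕP.≤-antisym (subst (_≤ M) (sym |σ′|≡1+|σ|) (ℕP.≰⇒> M≰|σ|)) M≤|σ′|

theorem4p12 : (M : ℕ) → 6 ≤ M → (σ : List Edge) → ValidStream σ →
    ((length σ ≤ M) → ∀ (p : ℚ) (s : State) → (p , s) ∈ triestImpr M σ →
        0ℚ Data.Rational.< p → counter s ≡ fromℕ (numTriangles σ))
    × ((M Data.Nat.< length σ) → 𝔼 (triestImpr M σ) counter ≡ fromℕ (numTriangles σ))
theorem4p12 M@(suc (suc m)) (s≤s (s≤s _)) σ valid = exact , unbiased
  where
  exact : length σ ≤ M → ∀ p s → (p , s) ∈ triestImpr M σ → 0ℚ ℚ.< p → counter s ≡ fromℕ (numTriangles σ)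
  exact |σ|≤M p s ps∈ _ =
    cong (counter ∘ proj₂) (AnyP.singleton⁻ (subst ((p , s) ∈_) (triestImpr-≤ M σ valid |σ|≤M) ps∈))
  unbiased : M < length σ → 𝔼 (triestImpr M σ) counter ≡ fromℕ (numTriangles σ)
  unbiased M<|σ| = Reservoir.Invariant.unbiased (Reservoir.Invariant-triestImpr m σ valid (ℕP.<⇒≤ M<|σ|))
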